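{- If a connected simple graph $\mathcal G$ with vertex set $n=\{0,1,\ldots,n-1\}$ has at least two central vertices, then $\mathcal G$ is perm-complete.
   Context: A vertex is central iff it is adjacent to every other vertex. Permutations compose left to right. For a finite sequence $\mathbf s$ in $\mathrm{Sym}(n)$, $\bigcirc\mathbf s$ is the composite of its terms in order, $\mathrm{Seq}(\mathbf s)$ the set of its rearrangements and $\mathrm{Prod}(\mathbf s)=\{\bigcirc\mathbf r:\mathbf r\in\mathrm{Seq}(\mathbf s)\}$; $\mathbf s$ is perm-complete iff $\mathrm{Prod}(\mathbf s)$ is $\mathrm{Alt}(n)$ or $\mathrm{Sym}(n)\setminus\mathrm{Alt}(n)$. A simple graph on vertex set $n$ is perm-complete iff the sequence listing each of its edges $(x\,y)$ exactly once as the transposition $(x\,y)\in\mathrm{Sym}(n)$ is perm-complete (the order of listing is irrelevant). -}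

module Defs where

open import Data.Nat using (ℕ; _%_)
open import Data.Bool using (Bool; true; false; if_then_else_; _∧_)
open import Data.Fin using (Fin; _<?_)
open import Data.Fin.Permutation using (Permutation′; _⟨$⟩ʳ_; _≈_; id; _∘ₚ_; transpose)
open import Data.List using (List; []; _∷_; map; foldr; concatMap; allFin)
open import Data.Nat.ListAction using (sum)
open import Data.List.Relation.Binary.Permutation.Propositional using (_↭_)
open import Data.Product using (Σ; _×_; _,_; ∃)
open import Data.Sum using (_⊎_)
open import Relation.Nullary using (¬_; does)
open import Relation.Binary.PropositionalEquality using (_≡_; _≢_)
open import Relation.Binary.Construct.Closure.ReflexiveTransitive using (Star)
open import Function.Bundles using (_⇔_)

-- Elements of Sym(n): stdlib permutations of Fin n, compared extensionally (_≈_).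

-- ⃝ s : composite of the terms of s in order, composing left to right
-- (π₁ ∘ₚ π₂ applies π₁ first).
⨀ : ∀ {n} → List (Permutation′ n) → Permutation′ n
⨀ = foldr _∘ₚ_ id

InProd : ∀ {n} → List (Permutation′ n) → Permutation′ n → Set
InProd s σ = Σ (List _) λ r → (r ↭ s) × (⨀ r ≈ σ)

inversions : ∀ {n} → Permutation′ n → ℕ
inversions {n} π =
  sum (map (λ i → sum (map (λ j →
    if does (i <? j) ∧ does ((π ⟨$⟩ʳ j) <? (π ⟨$⟩ʳ i)) then 1 else 0)
    (allFin n))) (allFin n))

IsEven : ∀ {n} → Permutation′ n → Set
IsEven π = inversions π % 2 ≡ 0

PermComplete : ∀ {n} → List (Permutation′ n) → Set
PermComplete {n} s =
  ((σ : Permutation′ n) → InProd s σ ⇔ IsEven σ) ⊎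
  ((σ : Permutation′ n) → InProd s σ ⇔ (¬ IsEven σ))

record SimpleGraph (n : ℕ) : Set where
  field
    adj   : Fin n → Fin n → Bool
    sym   : ∀ x y → adj x y ≡ adj y x
    irrefl : ∀ x → adj x x ≡ false

open SimpleGraph public

Adj : ∀ {n} → SimpleGraph n → Fin n → Fin n → Set
Adj G x y = adj G x y ≡ true

-- each edge {x,y} (x < y) listed exactly once, as the transposition (x y)
edgeTranspositions : ∀ {n} → SimpleGraph n → List (Permutation′ n)
edgeTranspositions {n} G =
  concatMap (λ i → concatMap (λ j →
    if does (i <? j) ∧ adj G i j then transpose i j ∷ [] else [])
    (allFin n)) (allFin n)

PermCompleteGraph : ∀ {n} → SimpleGraph n → Set
PermCompleteGraph G = PermComplete (edgeTranspositions G)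

Connected : ∀ {n} → SimpleGraph n → Set
Connected {n} G = (x y : Fin n) → Star (Adj G) x y

Central : ∀ {n} → SimpleGraph n → Fin n → Set
Central {n} G x = (y : Fin n) → y ≢ x → Adj G x y

module Submission where

-- The edges uv, uy, vy (y any other vertex) form a spanning "double star"
-- with an odd number of edges.  The main lemma (module DoubleStars) says that
-- the products of these edges, taken in every order, are exactly the odd
-- permutations.  It is proved by induction on the leaves, for a stronger
-- statement: the order can be chosen so that some prefix carries any
-- prescribed vertex to v.  In the step, the leaf treated as the newest one is
-- chosen according to the permutation, and its two edges are inserted into an
-- order for the smaller star in one of a few patterns.
-- All edges are transpositions, and the sign of a permutation (the parity of
-- its inversions, module Sign) is a homomorphism that is odd on
-- transpositions.  So a product of m edges has sign m, and putting each of
-- the remaining edges in front of an order for the double star moves the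
-- covered class to the other sign (module Arrangements).  Hence the products
-- of all edges of G form exactly the sign class of their number (module
-- EdgeLists splits G's edge list), which is perm-completeness.

module Swaps where

  open import Data.Nat using (ℕ)
  open import Data.Bool using (true; false; if_then_else_)
  open import Data.Fin using (Fin)
  open import Data.Fin.Properties using (_≟_; _<?_)
  open import Data.Fin.Permutation using (Permutation′; _⟨$⟩ʳ_; _⟨$⟩ˡ_; transpose; inverseˡ)
  import Data.Fin.Permutation.Components as PC
  open import Relation.Nullary using (Dec; does; yes; no)
  open import Relation.Nullary.Decidable using (dec-true; dec-false)
  open import Relation.Binary.PropositionalEquality
  open import Function using (_∘_)

  private variable n : ℕ

  ⟨$⟩ʳ-injective : (π : Permutation′ n) {i j : Fin n} → π ⟨$⟩ʳ i ≡ π ⟨$⟩ʳ j → i ≡ j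
  ⟨$⟩ʳ-injective π e = trans (sym (inverseˡ π)) (trans (cong (π ⟨$⟩ˡ_) e) (inverseˡ π))

  _⇄_ : Fin n → Fin n → Fin n → Fin n
  _⇄_ = PC.transpose

  ⇄-left : (a b : Fin n) → (a ⇄ b) a ≡ b
  ⇄-left a b rewrite dec-true (a ≟ a) refl = refl

  ⇄-other : (a b : Fin n) {k : Fin n} → k ≢ a → k ≢ b → (a ⇄ b) k ≡ k
  ⇄-other a b {k} k≢a k≢b rewrite dec-false (k ≟ a) k≢a | dec-false (k ≟ b) k≢b = refl

  ⇄-right : (a b : Fin n) → (a ⇄ b) b ≡ a
  ⇄-right a b = by-cases (b ≟ a)
    where
    by-cases : Dec (b ≡ a) → (a ⇄ b) b ≡ a
    by-cases (yes refl) = ⇄-left a a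
    by-cases (no b≢a) rewrite dec-false (b ≟ a) b≢a | dec-true (b ≟ b) refl = refl

  data ⇄-Case (a b k : Fin n) : Set where
    at-left : k ≡ a → ⇄-Case a b k
    at-right : k ≡ b → ⇄-Case a b k
    elsewhere : k ≢ a → k ≢ b → ⇄-Case a b k

  ⇄-case : (a b k : Fin n) → ⇄-Case a b k
  ⇄-case a b k with k ≟ a | k ≟ b
  ... | yes k≡a | _ = at-left k≡a
  ... | no _ | yes k≡b = at-right k≡b
  ... | no k≢a | no k≢b = elsewhere k≢a k≢b

  ⇄-sym : (a b k : Fin n) → (a ⇄ b) k ≡ (b ⇄ a) k
  ⇄-sym a b k with ⇄-case a b k
  ... | at-left refl = trans (⇄-left a b) (sym (⇄-right b a))
  ... | at-right refl = trans (⇄-right a b) (sym (⇄-left b a))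
  ... | elsewhere k≢a k≢b = trans (⇄-other a b k≢a k≢b) (sym (⇄-other b a k≢b k≢a))

  ⇄-involutive : (a b k : Fin n) → (a ⇄ b) ((a ⇄ b) k) ≡ k
  ⇄-involutive a b k = trans (⇄-sym a b ((a ⇄ b) k)) (PC.transpose-inverse b a {k})

  ⇄-conjugate : (π : Permutation′ n) (a b k : Fin n) →
    ((π ⟨$⟩ʳ a) ⇄ (π ⟨$⟩ʳ b)) (π ⟨$⟩ʳ k) ≡ π ⟨$⟩ʳ ((a ⇄ b) k)
  ⇄-conjugate π a b k with ⇄-case a b k
  ... | at-left refl = trans (⇄-left (π ⟨$⟩ʳ a) (π ⟨$⟩ʳ b)) (cong (π ⟨$⟩ʳ_) (sym (⇄-left a b)))
  ... | at-right refl = trans (⇄-right (π ⟨$⟩ʳ a) (π ⟨$⟩ʳ b)) (cong (π ⟨$⟩ʳ_) (sym (⇄-right a b)))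
  ... | elsewhere k≢a k≢b =
    trans (⇄-other (π ⟨$⟩ʳ a) (π ⟨$⟩ʳ b) (k≢a ∘ ⟨$⟩ʳ-injective π) (k≢b ∘ ⟨$⟩ʳ-injective π))
          (cong (π ⟨$⟩ʳ_) (sym (⇄-other a b k≢a k≢b)))

  -- The transposition of a and b, built with its smaller point first (the
  -- form in which edgeTranspositions lists the edges of a graph).
  ⟨_⇄_⟩ : Fin n → Fin n → Permutation′ n
  ⟨ a ⇄ b ⟩ = if does (a <? b) then transpose a b else transpose b a

  ⟨⇄⟩-action : (a b k : Fin n) → ⟨ a ⇄ b ⟩ ⟨$⟩ʳ k ≡ (a ⇄ b) k
  ⟨⇄⟩-action a b k with does (a <? b)
  ... | true = refl
  ... | false = ⇄-sym b a k

  ⟨⇄⟩-left : (a b : Fin n) → ⟨ a ⇄ b ⟩ ⟨$⟩ʳ a ≡ b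
  ⟨⇄⟩-left a b = trans (⟨⇄⟩-action a b a) (⇄-left a b)

  ⟨⇄⟩-right : (a b : Fin n) → ⟨ a ⇄ b ⟩ ⟨$⟩ʳ b ≡ a
  ⟨⇄⟩-right a b = trans (⟨⇄⟩-action a b b) (⇄-right a b)

  ⟨⇄⟩-other : (a b : Fin n) {k : Fin n} → k ≢ a → k ≢ b → ⟨ a ⇄ b ⟩ ⟨$⟩ʳ k ≡ k
  ⟨⇄⟩-other a b k≢a k≢b = trans (⟨⇄⟩-action a b _) (⇄-other a b k≢a k≢b)

module Sign where

  open Swaps
  open import Defs using (inversions; IsEven)
  open import Data.Nat using (ℕ; zero; suc; _+_; _%_)
  open import Data.Nat.ListAction renaming (sum to ℕsum)
  open import Data.List using (map; allFin; tabulate)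
  open import Data.List.Properties using (map-tabulate)
  open import Function.Bundles using (_⇔_; mk⇔)
  open import Data.Bool using (Bool; true; false; not; _∧_; _xor_; if_then_else_)
  open import Data.Bool.Properties using (xor-∧-commutativeRing; ∧-zeroʳ; ∧-identityʳ; ∧-comm; xor-identityʳ; xor-same; xor-assoc; not-distribˡ-xor; not-involutive)
  open import Data.Fin using (Fin; zero; suc; _<_; punchIn)
  open import Data.Fin.Properties using (_≟_; _<?_; <-cmp; <-irrefl; <-asym; <-trans; punchInᵢ≢i)
  open import Data.Fin.Permutation using (Permutation′; _⟨$⟩ʳ_; _⟨$⟩ˡ_; _≈_; id; flip; _∘ₚ_; transpose; inverseʳ)
  open import Algebra.Bundles using (CommutativeRing)
  open import Relation.Nullary using (does)
  open import Relation.Nullary.Decidable using (dec-true; dec-false)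
  open import Relation.Binary using (tri<; tri≈; tri>)
  open import Relation.Binary.PropositionalEquality
  open import Function using (_∘_)
  open import Data.Empty using (⊥-elim)

  -- Booleans as a ring (xor is addition, ∧ multiplication); sums are xor-sums.
  module 𝔹 = CommutativeRing xor-∧-commutativeRing
  open import Algebra.Properties.CommutativeMonoid.Sum 𝔹.+-commutativeMonoid
    using (sum; sum-cong-≗; sum-remove; sum-replicate-zero; ∑-comm; ∑-distrib-+; ∑-permute)
  open import Algebra.Properties.Semiring.Sum 𝔹.semiring using (*-distribˡ-sum)

  private variable n : ℕ

  ∑² : (Fin n → Fin n → Bool) → Bool
  ∑² F = sum λ i → sum λ j → F i j

  ∑²-cong : {F G : Fin n → Fin n → Bool} → (∀ i j → F i j ≡ G i j) → ∑² F ≡ ∑² G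
  ∑²-cong F≡G = sum-cong-≗ λ i → sum-cong-≗ (F≡G i)

  ∑²-xor : (F G : Fin n → Fin n → Bool) → ∑² (λ i j → F i j xor G i j) ≡ ∑² F xor ∑² G
  ∑²-xor F G = trans (sum-cong-≗ λ i → ∑-distrib-+ (F i) (G i)) (∑-distrib-+ (λ i → sum (F i)) (λ i → sum (G i)))

  ∑²-zero : {F : Fin n → Fin n → Bool} → (∀ i j → F i j ≡ false) → ∑² F ≡ false
  ∑²-zero {n} F≡0 = trans (sum-cong-≗ {n} λ i → trans (sum-cong-≗ {n} (F≡0 i)) (sum-replicate-zero n)) (sum-replicate-zero n)

  ∑²-permute : (F : Fin n → Fin n → Bool) (ρ : Permutation′ n) → ∑² F ≡ ∑² (λ i j → F (ρ ⟨$⟩ʳ i) (ρ ⟨$⟩ʳ j))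
  ∑²-permute F ρ = trans (∑-permute (λ i → sum (F i)) ρ) (sum-cong-≗ λ i → ∑-permute (F (ρ ⟨$⟩ʳ i)) ρ)

  ∑-∧ : (c : Bool) (f : Fin n → Bool) → sum (λ k → c ∧ f k) ≡ c ∧ sum f
  ∑-∧ c f = sym (*-distribˡ-sum c f)

  δ : Fin n → Fin n → Bool
  δ i a = does (i ≟ a)

  ∑-δ : (a : Fin n) (f : Fin n → Bool) → sum (λ k → δ k a ∧ f k) ≡ f a
  ∑-δ {suc n} a f = begin
    sum (λ k → δ k a ∧ f k)                                       ≡⟨ sum-remove {i = a} (λ k → δ k a ∧ f k) ⟩
    (δ a a ∧ f a) xor sum (λ k → δ (punchIn a k) a ∧ f (punchIn a k)) ≡⟨ cong₂ _xor_ (cong (_∧ f a) (dec-true (a ≟ a) refl)) (sum-cong-≗ {n} off-a) ⟩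
    f a xor sum {n} (λ _ → false)                                 ≡⟨ cong (f a xor_) (sum-replicate-zero n) ⟩
    f a xor false                                                 ≡⟨ xor-identityʳ (f a) ⟩
    f a                                                           ∎
    where
    open ≡-Reasoning
    off-a : ∀ k → δ (punchIn a k) a ∧ f (punchIn a k) ≡ false
    off-a k = cong (_∧ f (punchIn a k)) (dec-false (punchIn a k ≟ a) (punchInᵢ≢i a k))

  ∑-δ₁ : (a : Fin n) → sum (λ k → δ k a) ≡ true
  ∑-δ₁ a = trans (sum-cong-≗ λ k → sym (∧-identityʳ (δ k a))) (∑-δ a (λ _ → true))

  _<ᵇ_ : Fin n → Fin n → Bool
  i <ᵇ j = does (i <? j)

  <ᵇ-irrefl : (i : Fin n) → i <ᵇ i ≡ false
  <ᵇ-irrefl i = dec-false (i <? i) (<-irrefl refl)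

  <ᵇ-asym : {i j : Fin n} → i < j → j <ᵇ i ≡ false
  <ᵇ-asym {i = i} {j} i<j = dec-false (j <? i) (<-asym i<j)

  <ᵇ-flip : {i j : Fin n} → i ≢ j → j <ᵇ i ≡ not (i <ᵇ j)
  <ᵇ-flip {i = i} {j} i≢j with <-cmp i j
  ... | tri< i<j _ _ rewrite dec-true (i <? j) i<j = <ᵇ-asym i<j
  ... | tri≈ _ i≡j _ = ⊥-elim (i≢j i≡j)
  ... | tri> _ _ j<i rewrite dec-true (j <? i) j<i | <ᵇ-asym j<i = refl

  <ᵇ-both : (i j : Fin n) → i <ᵇ j ∧ j <ᵇ i ≡ false
  <ᵇ-both i j with <-cmp i j
  ... | tri< i<j _ _ rewrite <ᵇ-asym i<j = ∧-zeroʳ _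
  ... | tri≈ _ refl _ rewrite <ᵇ-irrefl i = refl
  ... | tri> _ _ j<i rewrite <ᵇ-asym j<i = refl

  ∑²-pairs : (X : Fin n → Fin n → Bool) → (∀ i → X i i ≡ false) →
    ∑² X ≡ ∑² (λ i j → i <ᵇ j ∧ (X i j xor X j i))
  ∑²-pairs {n} X diagonal = begin
    ∑² X                                                          ≡⟨ ∑²-cong {n} split ⟩
    ∑² (λ i j → (i <ᵇ j ∧ X i j) xor (j <ᵇ i ∧ X i j))            ≡⟨ ∑²-xor {n} _ _ ⟩
    ∑² (λ i j → i <ᵇ j ∧ X i j) xor ∑² (λ i j → j <ᵇ i ∧ X i j)   ≡⟨ cong (∑² (λ i j → i <ᵇ j ∧ X i j) xor_) (∑-comm (λ i j → j <ᵇ i ∧ X i j)) ⟩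
    ∑² (λ i j → i <ᵇ j ∧ X i j) xor ∑² (λ i j → i <ᵇ j ∧ X j i)   ≡⟨ ∑²-xor {n} _ _ ⟨
    ∑² (λ i j → (i <ᵇ j ∧ X i j) xor (i <ᵇ j ∧ X j i))            ≡⟨ ∑²-cong {n} (λ i j → 𝔹.distribˡ (i <ᵇ j) (X i j) (X j i)) ⟨
    ∑² (λ i j → i <ᵇ j ∧ (X i j xor X j i))                       ∎
    where
    open ≡-Reasoning
    split : ∀ i j → X i j ≡ (i <ᵇ j ∧ X i j) xor (j <ᵇ i ∧ X i j)
    split i j with <-cmp i j
    ... | tri< i<j _ _ rewrite dec-true (i <? j) i<j | <ᵇ-asym i<j = sym (xor-identityʳ (X i j))
    ... | tri≈ _ refl _ rewrite <ᵇ-irrefl i = diagonal i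
    ... | tri> _ _ j<i rewrite dec-true (j <? i) j<i | <ᵇ-asym j<i = refl

  parity : ℕ → Bool
  parity zero = false
  parity (suc m) = not (parity m)

  parity-+ : ∀ m k → parity (m + k) ≡ parity m xor parity k
  parity-+ zero k = refl
  parity-+ (suc m) k = trans (cong not (parity-+ m k)) (not-distribˡ-xor (parity m) (parity k))

  parity-indicator : ∀ c → parity (if c then 1 else 0) ≡ c
  parity-indicator true = refl
  parity-indicator false = refl

  parity-∑ : (f : Fin n → ℕ) → parity (ℕsum (tabulate f)) ≡ sum (parity ∘ f)
  parity-∑ {zero} f = refl
  parity-∑ {suc n} f = trans (parity-+ (f zero) _) (cong (parity (f zero) xor_) (parity-∑ (f ∘ suc)))

  parity-∑-allFin : (f : Fin n → ℕ) → parity (ℕsum (map f (allFin n))) ≡ sum (parity ∘ f)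
  parity-∑-allFin f = trans (cong (parity ∘ ℕsum) (map-tabulate (λ i → i) f)) (parity-∑ f)

  Inverts : Permutation′ n → Fin n → Fin n → Bool
  Inverts π i j = i <ᵇ j ∧ ((π ⟨$⟩ʳ j) <ᵇ (π ⟨$⟩ʳ i))

  between : Fin n → Fin n → Fin n → Bool
  between a b k = a <ᵇ k ∧ k <ᵇ b

  Inverts-transpose : {a b : Fin n} → a < b → ∀ i j →
    i <ᵇ j ∧ ((a ⇄ b) j <ᵇ (a ⇄ b) i) ≡ (δ i a ∧ δ j b) xor ((δ i a ∧ between a b j) xor (δ j b ∧ between a b i))
  Inverts-transpose {n} {a} {b} a<b = by-cases
    where
    a≢b : a ≢ b
    a≢b a≡b = <-irrefl a≡b a<b
    δ-self : ∀ k → δ k k ≡ true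
    δ-self k = dec-true (k ≟ k) refl
    δ-other : ∀ {k l} → k ≢ l → δ k l ≡ false
    δ-other {k} {l} k≢l = dec-false (k ≟ l) k≢l
    gap : ∀ k → b <ᵇ k ∧ k <ᵇ a ≡ false
    gap k with <-cmp b k
    ... | tri< b<k _ _ rewrite <ᵇ-asym (<-trans a<b b<k) = ∧-zeroʳ _
    ... | tri≈ b≮k _ _ rewrite dec-false (b <? k) b≮k = refl
    ... | tri> b≮k _ _ rewrite dec-false (b <? k) b≮k = refl
    by-cases : ∀ i j → i <ᵇ j ∧ ((a ⇄ b) j <ᵇ (a ⇄ b) i) ≡ (δ i a ∧ δ j b) xor ((δ i a ∧ between a b j) xor (δ j b ∧ between a b i))
    by-cases i j with ⇄-case a b i | ⇄-case a b j
    ... | at-left refl | at-left refl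
      rewrite <ᵇ-irrefl a | δ-self a | δ-other a≢b = refl
    ... | at-left refl | at-right refl
      rewrite ⇄-left a b | ⇄-right a b | <ᵇ-irrefl a | <ᵇ-irrefl b | dec-true (a <? b) a<b | δ-self a | δ-self b = refl
    ... | at-left refl | elsewhere j≢a j≢b
      rewrite ⇄-left a b | ⇄-other a b j≢a j≢b | δ-self a | δ-other j≢b = sym (xor-identityʳ _)
    ... | at-right refl | at-left refl
      rewrite <ᵇ-asym a<b | δ-other (≢-sym a≢b) | δ-other a≢b = refl
    ... | at-right refl | at-right refl
      rewrite <ᵇ-irrefl b | δ-self b | δ-other (≢-sym a≢b) = sym (∧-zeroʳ (a <ᵇ b))
    ... | at-right refl | elsewhere j≢a j≢b
      rewrite ⇄-right a b | ⇄-other a b j≢a j≢b | δ-other (≢-sym a≢b) | δ-other j≢b = gap j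
    ... | elsewhere i≢a i≢b | at-left refl
      rewrite ⇄-left a b | ⇄-other a b i≢a i≢b | δ-other i≢a | δ-other a≢b = trans (∧-comm (i <ᵇ a) (b <ᵇ i)) (gap i)
    ... | elsewhere i≢a i≢b | at-right refl
      rewrite ⇄-right a b | ⇄-other a b i≢a i≢b | δ-other i≢a | δ-self b = ∧-comm (i <ᵇ b) (a <ᵇ i)
    ... | elsewhere i≢a i≢b | elsewhere j≢a j≢b
      rewrite ⇄-other a b i≢a i≢b | ⇄-other a b j≢a j≢b | δ-other i≢a | δ-other j≢b = <ᵇ-both i j

  -- Hence a transposition has an odd number of inversions: the pairs (a , k)
  -- and (k , b) cancel, leaving (a , b).
  transpose-inversions-odd : {a b : Fin n} → a < b → ∑² (Inverts (transpose a b)) ≡ true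
  transpose-inversions-odd {n} {a} {b} a<b = begin
    ∑² (Inverts (transpose a b))              ≡⟨ ∑²-cong {n} (Inverts-transpose a<b) ⟩
    ∑² (λ i j → C i j xor (R i j xor K i j))  ≡⟨ ∑²-xor C (λ i j → R i j xor K i j) ⟩
    ∑² C xor ∑² (λ i j → R i j xor K i j)     ≡⟨ cong (∑² C xor_) (∑²-xor R K) ⟩
    ∑² C xor (∑² R xor ∑² K)                  ≡⟨ cong₂ (λ x y → x xor (y xor ∑² K)) corner row ⟩
    true xor (sum inside xor ∑² K)            ≡⟨ cong (λ x → true xor (sum inside xor x)) column ⟩
    true xor (sum inside xor sum inside)      ≡⟨ cong (true xor_) (xor-same (sum inside)) ⟩
    true                                      ∎
    where
    open ≡-Reasoning
    inside : Fin n → Bool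
    inside = between a b
    C R K : Fin n → Fin n → Bool
    C i j = δ i a ∧ δ j b
    R i j = δ i a ∧ inside j
    K i j = δ j b ∧ inside i
    corner : ∑² C ≡ true
    corner = trans (sum-cong-≗ λ i → trans (∑-∧ (δ i a) (λ j → δ j b)) (cong (δ i a ∧_) (∑-δ₁ b)))
                   (trans (sum-cong-≗ λ i → ∧-identityʳ (δ i a)) (∑-δ₁ a))
    row : ∑² R ≡ sum inside
    row = trans (sum-cong-≗ λ i → ∑-∧ (δ i a) inside) (∑-δ a (λ _ → sum inside))
    column : ∑² K ≡ sum inside
    column = sum-cong-≗ λ i → ∑-δ b (λ _ → inside i)

  -- Par π, the parity of the number of inversions of π (true = odd), is the
  -- sign of π.  It is kept abstract so that unification never unfolds it; only
  -- the lemmas in this block look inside.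
  abstract
    Par : Permutation′ n → Bool
    Par π = ∑² (Inverts π)

    Par-cong : {π ρ : Permutation′ n} → π ≈ ρ → Par π ≡ Par ρ
    Par-cong π≈ρ = ∑²-cong λ i j → cong₂ (λ x y → i <ᵇ j ∧ (x <ᵇ y)) (π≈ρ j) (π≈ρ i)

    Par-id : Par (id {n}) ≡ false
    Par-id {n} = ∑²-zero {n} <ᵇ-both

    -- Composing with ρ first changes the inversion parity by that of ρ⁻¹:
    -- reindex by ρ⁻¹, then compare the two orders pair by pair.
    Par-∘ₚ : (ρ π : Permutation′ n) → Par (ρ ∘ₚ π) xor Par π ≡ Par (flip ρ)
    Par-∘ₚ {n} ρ π = begin
      Par (ρ ∘ₚ π) xor Par π
        ≡⟨ cong (_xor Par π) (∑²-permute (Inverts (ρ ∘ₚ π)) (flip ρ)) ⟩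
      ∑² (λ i j → Inverts (ρ ∘ₚ π) (ρ⁻ i) (ρ⁻ j)) xor Par π
        ≡⟨ cong (_xor Par π) (∑²-cong {n} λ i j → cong₂ (λ x y → (ρ⁻ i <ᵇ ρ⁻ j) ∧ (x <ᵇ y)) (πρρ⁻ j) (πρρ⁻ i)) ⟩
      ∑² (λ i j → (ρ⁻ i <ᵇ ρ⁻ j) ∧ H i j) xor ∑² (λ i j → (i <ᵇ j) ∧ H i j)
        ≡⟨ ∑²-xor {n} _ _ ⟨
      ∑² (λ i j → ((ρ⁻ i <ᵇ ρ⁻ j) ∧ H i j) xor ((i <ᵇ j) ∧ H i j))
        ≡⟨ ∑²-cong {n} (λ i j → 𝔹.distribʳ (H i j) (ρ⁻ i <ᵇ ρ⁻ j) (i <ᵇ j)) ⟨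
      ∑² X
        ≡⟨ ∑²-pairs X (λ i → cong₂ (λ x y → (x xor y) ∧ H i i) (<ᵇ-irrefl (ρ⁻ i)) (<ᵇ-irrefl i)) ⟩
      ∑² (λ i j → i <ᵇ j ∧ (X i j xor X j i))
        ≡⟨ ∑²-cong {n} pair ⟩
      Par (flip ρ) ∎
      where
      open ≡-Reasoning
      ρ⁻ : Fin n → Fin n
      ρ⁻ i = ρ ⟨$⟩ˡ i
      πρρ⁻ : ∀ i → π ⟨$⟩ʳ (ρ ⟨$⟩ʳ ρ⁻ i) ≡ π ⟨$⟩ʳ i
      πρρ⁻ i = cong (π ⟨$⟩ʳ_) (inverseʳ ρ)
      H X : Fin n → Fin n → Bool
      H i j = (π ⟨$⟩ʳ j) <ᵇ (π ⟨$⟩ʳ i)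
      X i j = ((ρ⁻ i <ᵇ ρ⁻ j) xor (i <ᵇ j)) ∧ H i j
      -- for i < j the two orientations together contribute "ρ⁻¹ inverts (i, j)"
      both : ∀ A h → ((A xor true) ∧ h) xor ((not A xor false) ∧ not h) ≡ not A
      both false false = refl
      both false true = refl
      both true false = refl
      both true true = refl
      pair : ∀ i j → i <ᵇ j ∧ (X i j xor X j i) ≡ i <ᵇ j ∧ (ρ⁻ j <ᵇ ρ⁻ i)
      pair i j with <-cmp i j
      ... | tri≈ i≮j _ _ rewrite dec-false (i <? j) i≮j = refl
      ... | tri> i≮j _ _ rewrite dec-false (i <? j) i≮j = refl
      ... | tri< i<j _ _
        rewrite dec-true (i <? j) i<j
              | <ᵇ-asym i<j
              | <ᵇ-flip {i = ρ⁻ i} {ρ⁻ j} (λ e → <-irrefl (⟨$⟩ʳ-injective (flip ρ) e) i<j)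
              | <ᵇ-flip {i = π ⟨$⟩ʳ j} {π ⟨$⟩ʳ i} (λ e → <-irrefl (sym (⟨$⟩ʳ-injective π e)) i<j)
        = both (ρ⁻ i <ᵇ ρ⁻ j) (H i j)

    Par-transpose : {a b : Fin n} → a < b → Par (transpose a b) ≡ true
    Par-transpose = transpose-inversions-odd

    parity-inversions : (π : Permutation′ n) → parity (inversions π) ≡ Par π
    parity-inversions {n} π =
      trans (parity-∑-allFin row) (sum-cong-≗ {n} λ i → trans (parity-∑-allFin (cell i)) (sum-cong-≗ {n} λ j → parity-indicator (Inverts π i j)))
      where
      cell : Fin n → Fin n → ℕ
      cell i j = if Inverts π i j then 1 else 0
      row : Fin n → ℕ
      row i = ℕsum (map (cell i) (allFin n))

  Par-flip : (ρ : Permutation′ n) → Par (flip ρ) ≡ Par ρ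
  Par-flip {n} ρ = trans (sym (Par-∘ₚ ρ id)) (trans (cong (Par ρ xor_) (Par-id {n})) (xor-identityʳ (Par ρ)))

  Par-hom : (ρ π : Permutation′ n) → Par (ρ ∘ₚ π) ≡ Par ρ xor Par π
  Par-hom ρ π = begin
    Par (ρ ∘ₚ π)                          ≡⟨ xor-identityʳ _ ⟨
    Par (ρ ∘ₚ π) xor false                ≡⟨ cong (Par (ρ ∘ₚ π) xor_) (xor-same (Par π)) ⟨
    Par (ρ ∘ₚ π) xor (Par π xor Par π)    ≡⟨ xor-assoc (Par (ρ ∘ₚ π)) (Par π) (Par π) ⟨
    (Par (ρ ∘ₚ π) xor Par π) xor Par π    ≡⟨ cong (_xor Par π) (trans (Par-∘ₚ ρ π) (Par-flip ρ)) ⟩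
    Par ρ xor Par π                       ∎
    where open ≡-Reasoning

  Par-⟨⇄⟩ : {a b : Fin n} → a ≢ b → Par ⟨ a ⇄ b ⟩ ≡ true
  Par-⟨⇄⟩ {a = a} {b} a≢b with <-cmp a b
  ... | tri< a<b _ _ rewrite dec-true (a <? b) a<b = Par-transpose a<b
  ... | tri≈ _ a≡b _ = ⊥-elim (a≢b a≡b)
  ... | tri> a≮b _ b<a rewrite dec-false (a <? b) a≮b = Par-transpose b<a

  %2-parity : ∀ m → m % 2 ≡ (if parity m then 1 else 0)
  %2-parity zero = refl
  %2-parity (suc zero) = refl
  %2-parity (suc (suc m)) = trans (%2-parity m) (cong (λ c → if c then 1 else 0) (sym (not-involutive (parity m))))

  even⇔parity≡false : ∀ m → (m % 2 ≡ 0) ⇔ (parity m ≡ false)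
  even⇔parity≡false m = mk⇔ to (λ even → trans (%2-parity m) (cong (λ c → if c then 1 else 0) even))
    where
    to : m % 2 ≡ 0 → parity m ≡ false
    to m%2≡0 with parity m | %2-parity m
    ... | false | _ = refl
    ... | true | m%2≡1 with () ← trans (sym m%2≡1) m%2≡0

  IsEven⇔Par≡false : (π : Permutation′ n) → IsEven π ⇔ (Par π ≡ false)
  IsEven⇔Par≡false π = subst (λ c → IsEven π ⇔ (c ≡ false)) (parity-inversions π) (even⇔parity≡false (inversions π))

module Arrangements where

  open import Defs using (⨀; InProd; PermComplete)
  open Swaps
  open Sign
  open import Data.Nat using (ℕ)
  open import Data.Bool using (Bool; true; false; not; _xor_)
  open import Data.Bool.Properties using (not-distribˡ-xor; ¬-not; true-xor; not-involutive)
  open import Data.Fin using (Fin)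
  open import Data.Fin.Permutation using (Permutation′; _⟨$⟩ʳ_; _∘ₚ_)
  open import Data.List using (List; []; _∷_; _++_; length)
  open import Data.List.Relation.Unary.All using (All; []; _∷_)
  open import Data.List.Relation.Binary.Permutation.Propositional using (_↭_; ↭-sym; ↭-trans; prep)
  open import Data.List.Relation.Binary.Permutation.Propositional.Properties using (↭-length; All-resp-↭)
  open import Data.Product using (_,_)
  open import Data.Sum using (inj₁; inj₂)
  open import Function.Bundles using (mk⇔; Equivalence)
  open import Relation.Binary.PropositionalEquality

  private variable n : ℕ

  ⨀-++ : (α β : List (Permutation′ n)) (k : Fin n) → ⨀ (α ++ β) ⟨$⟩ʳ k ≡ ⨀ β ⟨$⟩ʳ (⨀ α ⟨$⟩ʳ k)
  ⨀-++ [] β k = refl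
  ⨀-++ (t ∷ α) β k = ⨀-++ α β (t ⟨$⟩ʳ k)

  record IsTransposition (t : Permutation′ n) : Set where
    constructor swaps
    field
      {left right} : Fin n
      distinct : left ≢ right
      action : ∀ k → t ⟨$⟩ʳ k ≡ (left ⇄ right) k

  ⟨⇄⟩-IsTransposition : {a b : Fin n} → a ≢ b → IsTransposition ⟨ a ⇄ b ⟩
  ⟨⇄⟩-IsTransposition {a = a} {b} a≢b = swaps a≢b (⟨⇄⟩-action a b)

  Par-transposition : {t : Permutation′ n} → IsTransposition t → Par t ≡ true
  Par-transposition {t = t} (swaps {a} {b} a≢b t≈) =
    trans (Par-cong {π = t} {⟨ a ⇄ b ⟩} λ k → trans (t≈ k) (sym (⟨⇄⟩-action a b k))) (Par-⟨⇄⟩ a≢b)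

  transposition-involutive : {t : Permutation′ n} → IsTransposition t → ∀ k → t ⟨$⟩ʳ (t ⟨$⟩ʳ k) ≡ k
  transposition-involutive {t = t} (swaps {a} {b} _ t≈) k = trans (t≈ (t ⟨$⟩ʳ k)) (trans (cong (a ⇄ b) (t≈ k)) (⇄-involutive a b k))

  Par-⨀ : {r : List (Permutation′ n)} → All IsTransposition r → Par (⨀ r) ≡ parity (length r)
  Par-⨀ {n} [] = Par-id {n}
  Par-⨀ {r = t ∷ r} (t-trans ∷ r-trans) = begin
    Par (t ∘ₚ ⨀ r)              ≡⟨ Par-hom t (⨀ r) ⟩
    Par t xor Par (⨀ r)         ≡⟨ cong₂ _xor_ (Par-transposition t-trans) (Par-⨀ r-trans) ⟩
    not (parity (length r))     ∎
    where open ≡-Reasoning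

  InProd-parity : {s : List (Permutation′ n)} → All IsTransposition s → ∀ {σ} → InProd s σ → Par σ ≡ parity (length s)
  InProd-parity s-trans {σ} (r , r↭s , ⨀r≈σ) =
    trans (sym (Par-cong {π = ⨀ r} {σ} ⨀r≈σ)) (trans (Par-⨀ (All-resp-↭ (↭-sym r↭s) s-trans)) (cong parity (↭-length r↭s)))

  Covers : List (Permutation′ n) → Bool → Set
  Covers {n} s p = (σ : Permutation′ n) → Par σ ≡ p → InProd s σ

  Covers-resp-↭ : {s s′ : List (Permutation′ n)} → s ↭ s′ → ∀ {p} → Covers s p → Covers s′ p
  Covers-resp-↭ s↭s′ covers σ par with covers σ par
  ... | r , r↭s , ⨀r≈σ = r , ↭-trans r↭s s↭s′ , ⨀r≈σ

  -- Putting one more transposition in front flips the covered class: σ = t (t σ).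
  Covers-∷ : {t : Permutation′ n} {s : List (Permutation′ n)} {p : Bool} →
    IsTransposition t → Covers s p → Covers (t ∷ s) (not p)
  Covers-∷ {t = t} {p = p} t-trans covers σ par with covers (t ∘ₚ σ) tσ-parity
    where
    tσ-parity : Par (t ∘ₚ σ) ≡ p
    tσ-parity = trans (Par-hom t σ) (trans (cong₂ _xor_ (Par-transposition t-trans) par) (trans (true-xor (not p)) (not-involutive p)))
  ... | r , r↭s , ⨀r≈tσ = t ∷ r , prep t r↭s , λ k → trans (⨀r≈tσ (t ⟨$⟩ʳ k)) (cong (σ ⟨$⟩ʳ_) (transposition-involutive t-trans k))

  Covers-++ : {X s : List (Permutation′ n)} {p : Bool} →
    All IsTransposition X → Covers s p → Covers (X ++ s) (parity (length X) xor p)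
  Covers-++ [] covers = covers
  Covers-++ {X = t ∷ X} {s} {p} (t-trans ∷ X-trans) covers =
    subst (Covers (t ∷ X ++ s)) (not-distribˡ-xor (parity (length X)) p) (Covers-∷ t-trans (Covers-++ X-trans covers))

  PermComplete-by-parity : {s : List (Permutation′ n)} → All IsTransposition s → Covers s (parity (length s)) → PermComplete s
  PermComplete-by-parity {s = s} s-trans covers with parity (length s) in eq
  ... | false = inj₁ λ σ → mk⇔
    (λ σ∈ → Equivalence.from (IsEven⇔Par≡false σ) (trans (InProd-parity s-trans {σ} σ∈) eq))
    (λ even → covers σ (Equivalence.to (IsEven⇔Par≡false σ) even))
  ... | true = inj₂ λ σ → mk⇔
    (λ σ∈ even → true≢false (trans (sym (trans (InProd-parity s-trans {σ} σ∈) eq)) (Equivalence.to (IsEven⇔Par≡false σ) even)))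
    (λ odd → covers σ (¬-not λ Par≡false → odd (Equivalence.from (IsEven⇔Par≡false σ) Par≡false)))
    where
    true≢false : true ≢ false
    true≢false ()

module DoubleStars where

  open import Defs using (⨀)
  open Swaps
  open Sign
  open Arrangements
  open import Data.Nat using (ℕ; zero; suc)
  open import Data.Nat.Properties using (suc-injective)
  open import Data.Bool using (true; false; _xor_)
  open import Data.Bool.Properties using (not-involutive)
  open import Data.Empty using (⊥; ⊥-elim)
  open import Data.Fin using (Fin)
  open import Data.Fin.Properties using (_≟_)
  open import Data.Fin.Permutation using (Permutation′; _⟨$⟩ʳ_; _⟨$⟩ˡ_; _≈_; id; flip; _∘ₚ_; inverseˡ; inverseʳ)
  open import Data.List using (List; []; _∷_; _++_; length)
  open import Data.List.Properties using (++-assoc; ++-identityʳ; length-++)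
  open import Data.List.Membership.Propositional using (_∈_; _∉_)
  open import Data.List.Membership.Propositional.Properties using (∈-∃++; ∈-++⁻)
  open import Data.List.Relation.Unary.Any using (here; there)
  open import Data.List.Relation.Unary.All as All using (All; []; _∷_)
  open import Data.List.Relation.Unary.Unique.Propositional using (Unique)
  open import Data.List.Relation.Unary.AllPairs using ([]; _∷_)
  open import Data.List.Relation.Unary.All.Properties using (All¬⇒¬Any; ++⁻ˡ; ++⁻ʳ)
  open import Data.List.Relation.Binary.Permutation.Propositional using (_↭_; ↭-refl; ↭-sym; ↭-trans; prep; swap; module PermutationReasoning)
  open import Data.List.Relation.Binary.Permutation.Propositional.Properties using (shift; shifts; ++⁺ˡ; ++⁺ʳ; ++-comm; ∈-resp-↭; All-resp-↭; ↭-length)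
  open import Data.Product using (_×_; _,_; proj₁; proj₂)
  open import Data.Sum using (_⊎_; inj₁; inj₂)
  open import Relation.Nullary using (yes; no)
  open import Relation.Binary.PropositionalEquality
  open import Relation.Binary.PropositionalEquality.Properties using (setoid)
  open import Function using (_∘_)

  private variable n : ℕ

  Perm : ℕ → Set
  Perm = Permutation′

  record SupportedIn (S : List (Fin n)) (σ : Perm n) : Set where
    constructor supported
    field fixes-outside : ∀ k → k ∉ S → σ ⟨$⟩ʳ k ≡ k
  open SupportedIn public

  module _ {S : List (Fin n)} {σ : Perm n} (σ-in-S : SupportedIn S σ) where
    open import Data.List.Membership.DecPropositional (_≟_ {n}) using (_∈?_)

    supported-preserves : ∀ {k} → k ∈ S → σ ⟨$⟩ʳ k ∈ S
    supported-preserves {k} k∈S with σ ⟨$⟩ʳ k ∈? S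
    ... | yes σk∈S = σk∈S
    ... | no σk∉S = subst (_∈ S) (sym (⟨$⟩ʳ-injective σ (fixes-outside σ-in-S _ σk∉S))) k∈S

    supported-reflects : ∀ {k} → σ ⟨$⟩ʳ k ∈ S → k ∈ S
    supported-reflects {k} σk∈S with k ∈? S
    ... | yes k∈S = k∈S
    ... | no k∉S = subst (_∈ S) (fixes-outside σ-in-S k k∉S) σk∈S

    supported-flip : SupportedIn S (flip σ)
    supported-flip = supported λ k k∉S → trans (cong (σ ⟨$⟩ˡ_) (sym (fixes-outside σ-in-S k k∉S))) (inverseˡ σ)

  supported-∘ₚ : {S : List (Fin n)} {ρ σ : Perm n} → SupportedIn S ρ → SupportedIn S σ → SupportedIn S (ρ ∘ₚ σ)
  supported-∘ₚ {σ = σ} ρ-in-S σ-in-S =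
    supported λ k k∉S → trans (cong (σ ⟨$⟩ʳ_) (fixes-outside ρ-in-S k k∉S)) (fixes-outside σ-in-S k k∉S)

  supported-⨀ : {S : List (Fin n)} {r : List (Perm n)} → All (SupportedIn S) r → SupportedIn S (⨀ r)
  supported-⨀ [] = supported λ _ _ → refl
  supported-⨀ {r = t ∷ r} (t-in-S ∷ r-in-S) = supported-∘ₚ {ρ = t} {⨀ r} t-in-S (supported-⨀ r-in-S)

  supported-⟨⇄⟩ : {S : List (Fin n)} {a b : Fin n} → a ∈ S → b ∈ S → SupportedIn S ⟨ a ⇄ b ⟩
  supported-⟨⇄⟩ {a = a} {b} a∈S b∈S = supported λ k k∉S → ⟨⇄⟩-other a b (λ { refl → k∉S a∈S }) (λ { refl → k∉S b∈S })

  ⨀-fixes : {k : Fin n} {r : List (Perm n)} → All (λ t → t ⟨$⟩ʳ k ≡ k) r → ⨀ r ⟨$⟩ʳ k ≡ k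
  ⨀-fixes [] = refl
  ⨀-fixes {k = k} {r = t ∷ r} (tk≡k ∷ r-fixes) = trans (cong (⨀ r ⟨$⟩ʳ_) tk≡k) (⨀-fixes r-fixes)

  module DoubleStar {n} (u v : Fin n) (u≢v : u ≢ v) where

    Span : List (Fin n) → List (Fin n)
    Span L = u ∷ v ∷ L

    leafEdges : List (Fin n) → List (Perm n)
    leafEdges [] = []
    leafEdges (y ∷ L) = ⟨ u ⇄ y ⟩ ∷ ⟨ v ⇄ y ⟩ ∷ leafEdges L

    Edges : List (Fin n) → List (Perm n)
    Edges L = ⟨ u ⇄ v ⟩ ∷ leafEdges L

    leafEdges-↭ : {L L′ : List (Fin n)} → L ↭ L′ → leafEdges L ↭ leafEdges L′
    leafEdges-↭ _↭_.refl = ↭-refl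
    leafEdges-↭ (_↭_.prep y L↭L′) = prep _ (prep _ (leafEdges-↭ L↭L′))
    leafEdges-↭ (_↭_.swap y z L↭L′) =
      ↭-trans (shifts (⟨ u ⇄ y ⟩ ∷ ⟨ v ⇄ y ⟩ ∷ []) (⟨ u ⇄ z ⟩ ∷ ⟨ v ⇄ z ⟩ ∷ []))
              (prep _ (prep _ (prep _ (prep _ (leafEdges-↭ L↭L′)))))
    leafEdges-↭ (_↭_.trans L↭L′ L′↭L″) = ↭-trans (leafEdges-↭ L↭L′) (leafEdges-↭ L′↭L″)

    Edges-supported : (L : List (Fin n)) → All (SupportedIn (Span L)) (Edges L)
    Edges-supported L = supported-⟨⇄⟩ (here refl) (there (here refl)) ∷ leaves L (there ∘ there)
      where
      leaves : (L′ : List (Fin n)) → (∀ {y} → y ∈ L′ → y ∈ Span L) → All (SupportedIn (Span L)) (leafEdges L′)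
      leaves [] _ = []
      leaves (y ∷ L′) L′⊆ = supported-⟨⇄⟩ (here refl) (L′⊆ (here refl)) ∷ supported-⟨⇄⟩ (there (here refl)) (L′⊆ (here refl))
                            ∷ leaves L′ (L′⊆ ∘ there)

    -- σ is the product of a rearrangement of s having a prefix that carries x to v.
    -- (Remembering such prefixes is what lets an induction on the leaves go through.)
    record Run (s : List (Perm n)) (σ : Perm n) (x : Fin n) : Set where
      constructor run
      field
        order : List (Perm n)
        rearranges : order ↭ s
        product : ⨀ order ≈ σ
        before after : List (Perm n)
        split : order ≡ before ++ after
        visits : ⨀ before ⟨$⟩ʳ x ≡ v

    run-from-v : {s order : List (Perm n)} {σ : Perm n} → order ↭ s → ⨀ order ≈ σ → Run s σ v
    run-from-v {order = order} order↭s ⨀≈σ = run order order↭s ⨀≈σ [] order refl refl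

    run-to-v : {s order : List (Perm n)} {σ : Perm n} {x : Fin n} → order ↭ s → ⨀ order ≈ σ → σ ⟨$⟩ʳ x ≡ v → Run s σ x
    run-to-v {order = order} {x = x} order↭s ⨀≈σ σx≡v =
      run order order↭s ⨀≈σ order [] (sym (++-identityʳ order)) (trans (⨀≈σ x) σx≡v)

    Run-at-v : {s : List (Perm n)} {σ : Perm n} {x : Fin n} → Run s σ x → Run s σ v
    Run-at-v (run _ order↭s ⨀≈σ _ _ _ _) = run-from-v order↭s ⨀≈σ

    Run-resp-↭ : {s s′ : List (Perm n)} {σ : Perm n} {x : Fin n} → s ↭ s′ → Run s σ x → Run s′ σ x
    Run-resp-↭ s↭s′ (run order order↭s ⨀≈σ α β split visits) = run order (↭-trans order↭s s↭s′) ⨀≈σ α β split visits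

    -- Framing: from a run of π, the order P r Q gives a run of σ = P π Q,
    -- visiting every x that P carries to the point visited for π.
    frame : {s s′ : List (Perm n)} {π σ : Perm n} {x′ : Fin n} (P Q : List (Perm n)) →
      (∀ {r} → r ↭ s → P ++ r ++ Q ↭ s′) →
      (∀ k → ⨀ Q ⟨$⟩ʳ (π ⟨$⟩ʳ (⨀ P ⟨$⟩ʳ k)) ≡ σ ⟨$⟩ʳ k) →
      Run s π x′ → ∀ x → (⨀ P ⟨$⟩ʳ x ≡ x′) ⊎ (x ≡ v) ⊎ (σ ⟨$⟩ʳ x ≡ v) → Run s′ σ x
    frame {π = π} {σ} {x′} P Q rearrange conjugate (run r r↭s ⨀r≈π α β r≡αβ visits) x how = visiting how
      where
      product : ⨀ (P ++ r ++ Q) ≈ σ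
      product k = begin
        ⨀ (P ++ r ++ Q) ⟨$⟩ʳ k               ≡⟨ ⨀-++ P (r ++ Q) k ⟩
        ⨀ (r ++ Q) ⟨$⟩ʳ (⨀ P ⟨$⟩ʳ k)         ≡⟨ ⨀-++ r Q _ ⟩
        ⨀ Q ⟨$⟩ʳ (⨀ r ⟨$⟩ʳ (⨀ P ⟨$⟩ʳ k))     ≡⟨ cong (⨀ Q ⟨$⟩ʳ_) (⨀r≈π _) ⟩
        ⨀ Q ⟨$⟩ʳ (π ⟨$⟩ʳ (⨀ P ⟨$⟩ʳ k))       ≡⟨ conjugate k ⟩
        σ ⟨$⟩ʳ k                             ∎
        where open ≡-Reasoning
      visiting : (⨀ P ⟨$⟩ʳ x ≡ x′) ⊎ (x ≡ v) ⊎ (σ ⟨$⟩ʳ x ≡ v) → Run _ σ x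
      visiting (inj₁ Px≡x′) = run (P ++ r ++ Q) (rearrange r↭s) product (P ++ α) (β ++ Q) split
        (trans (⨀-++ P α x) (trans (cong (⨀ α ⟨$⟩ʳ_) Px≡x′) visits))
        where
        split : P ++ r ++ Q ≡ (P ++ α) ++ β ++ Q
        split rewrite r≡αβ | ++-assoc α β Q = sym (++-assoc P α (β ++ Q))
      visiting (inj₂ (inj₁ refl)) = run-from-v (rearrange r↭s) product
      visiting (inj₂ (inj₂ σx≡v)) = run-to-v (rearrange r↭s) product σx≡v

    Claim : List (Fin n) → Set
    Claim L = Unique (Span L) → ∀ σ → SupportedIn (Span L) σ → Par σ ≡ true → ∀ x → x ∈ Span L → Run (Edges L) σ x

    -- Without leaves, the only odd permutation of {u, v} is the edge uv itself.
    claim-[] : Claim []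
    claim-[] _ σ σ-in σ-odd x x∈ = visiting x∈
      where
      hub : ∀ {k} → k ∈ Span [] → k ≡ u ⊎ k ≡ v
      hub (here k≡u) = inj₁ k≡u
      hub (there (here k≡v)) = inj₂ k≡v
      -- if σ fixed u it would fix v as well, and be even
      fixing-u-is-even : σ ⟨$⟩ʳ u ≡ u → ⊥
      fixing-u-is-even σu≡u = true≢false (trans (sym σ-odd) (trans (Par-cong {π = σ} {id} σ≈id) (Par-id {n})))
        where
        true≢false : true ≢ false
        true≢false ()
        σv≡v : σ ⟨$⟩ʳ v ≡ v
        σv≡v with hub (supported-preserves σ-in {v} (there (here refl)))
        ... | inj₁ σv≡u = ⊥-elim (u≢v (⟨$⟩ʳ-injective σ (trans σu≡u (sym σv≡u))))
        ... | inj₂ σv≡v = σv≡v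
        σ≈id : σ ≈ id
        σ≈id k with k ≟ u | k ≟ v
        ... | yes refl | _ = σu≡u
        ... | no _ | yes refl = σv≡v
        ... | no k≢u | no k≢v = fixes-outside σ-in k λ { (here k≡u) → k≢u k≡u ; (there (here k≡v)) → k≢v k≡v }
      σ-moves-u : σ ⟨$⟩ʳ u ≡ v
      σ-moves-u with hub (supported-preserves σ-in {u} (here refl))
      ... | inj₂ σu≡v = σu≡v
      ... | inj₁ σu≡u = ⊥-elim (fixing-u-is-even σu≡u)
      σ-moves-v : σ ⟨$⟩ʳ v ≡ u
      σ-moves-v with hub (supported-preserves σ-in {v} (there (here refl)))
      ... | inj₁ σv≡u = σv≡u
      ... | inj₂ σv≡v = ⊥-elim (u≢v (⟨$⟩ʳ-injective σ (trans σ-moves-u (sym σv≡v))))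
      σ≈uv : ⨀ (⟨ u ⇄ v ⟩ ∷ []) ≈ σ
      σ≈uv k with k ≟ u | k ≟ v
      ... | yes refl | _ = trans (⟨⇄⟩-left u v) (sym σ-moves-u)
      ... | no _ | yes refl = trans (⟨⇄⟩-right u v) (sym σ-moves-v)
      ... | no k≢u | no k≢v = trans (⟨⇄⟩-other u v k≢u k≢v) (sym (fixes-outside σ-in k λ { (here k≡u) → k≢u k≡u ; (there (here k≡v)) → k≢v k≡v }))
      visiting : x ∈ Span [] → Run (Edges []) σ x
      visiting (here refl) = run-to-v ↭-refl σ≈uv σ-moves-u
      visiting (there (here refl)) = run-from-v ↭-refl σ≈uv

    -- Each lemma below realises σ (odd, on the vertices of y ∷ L) under one
    -- condition on σ, by inserting the new edges uy, vy into an order of the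
    -- old edges obtained from the claim for L.
    module Step (y : Fin n) (L : List (Fin n)) (fresh : Unique (Span (y ∷ L))) (claim-L : Claim L)
                (σ : Perm n) (σ-in : SupportedIn (Span (y ∷ L)) σ) (σ-odd : Par σ ≡ true) where

      uy vy uv : Perm n
      uy = ⟨ u ⇄ y ⟩
      vy = ⟨ v ⇄ y ⟩
      uv = ⟨ u ⇄ v ⟩

      freshness : (y ≢ u) × (y ≢ v) × (y ∉ L) × Unique (Span L)
      freshness = unpack fresh
        where
        unpack : Unique (u ∷ v ∷ y ∷ L) → (y ≢ u) × (y ≢ v) × (y ∉ L) × Unique (Span L)
        unpack ((u≢v ∷ u≢y ∷ u∉L) ∷ (v≢y ∷ v∉L) ∷ y∉L ∷ unique) =
          ≢-sym u≢y , ≢-sym v≢y , All¬⇒¬Any y∉L , (u≢v ∷ u∉L) ∷ v∉L ∷ unique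
      y≢u : y ≢ u
      y≢u = proj₁ freshness
      y≢v : y ≢ v
      y≢v = proj₁ (proj₂ freshness)
      y∉L : y ∉ L
      y∉L = proj₁ (proj₂ (proj₂ freshness))
      unique-L : Unique (Span L)
      unique-L = proj₂ (proj₂ (proj₂ freshness))

      y∉Span-L : y ∉ Span L
      y∉Span-L (here y≡u) = y≢u y≡u
      y∉Span-L (there (here y≡v)) = y≢v y≡v
      y∉Span-L (there (there y∈L)) = y∉L y∈L

      u∈ : u ∈ Span (y ∷ L)
      u∈ = here refl
      v∈ : v ∈ Span (y ∷ L)
      v∈ = there (here refl)
      y∈ : y ∈ Span (y ∷ L)
      y∈ = there (there (here refl))

      shrink : ∀ {k} → k ∈ Span (y ∷ L) → k ≢ y → k ∈ Span L
      shrink (here k≡u) _ = here k≡u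
      shrink (there (here k≡v)) _ = there (here k≡v)
      shrink (there (there (here k≡y))) k≢y = ⊥-elim (k≢y k≡y)
      shrink (there (there (there k∈L))) _ = there (there k∈L)

      shrink-support : ∀ {π} → SupportedIn (Span (y ∷ L)) π → π ⟨$⟩ʳ y ≡ y → SupportedIn (Span L) π
      shrink-support {π} π-in πy≡y = supported fixes
        where
        fixes : ∀ k → k ∉ Span L → π ⟨$⟩ʳ k ≡ k
        fixes k k∉ with k ≟ y
        ... | yes refl = πy≡y
        ... | no k≢y = fixes-outside π-in k λ k∈ → k∉ (shrink k∈ k≢y)

      -- the old edges never move y, so neither does any product of some of them
      prefix-fixes-y : ∀ {r α β} → r ↭ Edges L → r ≡ α ++ β → ⨀ α ⟨$⟩ʳ y ≡ y
      prefix-fixes-y {α = α} r↭ r≡αβ =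
        ⨀-fixes (++⁻ˡ α (subst (All (λ t → t ⟨$⟩ʳ y ≡ y)) r≡αβ (All-resp-↭ (↭-sym r↭) old-edges-fix-y)))
        where
        old-edges-fix-y : All (λ t → t ⟨$⟩ʳ y ≡ y) (Edges L)
        old-edges-fix-y = All.map (λ t-in → fixes-outside t-in y y∉Span-L) (Edges-supported L)

      extend : ∀ {r} → r ↭ Edges L → uy ∷ vy ∷ r ↭ Edges (y ∷ L)
      extend r↭ = ↭-trans (prep uy (prep vy r↭)) (shift uv (uy ∷ vy ∷ []) (leafEdges L))

      claim-at : ∀ {π} → SupportedIn (Span (y ∷ L)) π → π ⟨$⟩ʳ y ≡ y → Par π ≡ true → ∀ x → x ∈ Span L → Run (Edges L) π x
      claim-at π-in πy≡y π-odd = claim-L unique-L _ (shrink-support π-in πy≡y) π-odd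

      -- Sandwich: place the new edges as a prefix P and a suffix Q around an old
      -- order.  This realises σ = P π Q with π = P⁻¹ σ Q⁻¹, provided π fixes y,
      -- i.e. σ sends the point z with P z = y to Q y.
      module Sandwich (P Q : List (Perm n)) (PQ↭ : P ++ Q ↭ uy ∷ vy ∷ [])
                      (z : Fin n) (Pz≡y : ⨀ P ⟨$⟩ʳ z ≡ y) (σz≡Qy : σ ⟨$⟩ʳ z ≡ ⨀ Q ⟨$⟩ʳ y) where
        new-edges : All (λ t → IsTransposition t × SupportedIn (Span (y ∷ L)) t) (P ++ Q)
        new-edges = All-resp-↭ (↭-sym PQ↭)
          ((⟨⇄⟩-IsTransposition (≢-sym y≢u) , supported-⟨⇄⟩ u∈ y∈) ∷ (⟨⇄⟩-IsTransposition (≢-sym y≢v) , supported-⟨⇄⟩ v∈ y∈) ∷ [])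
        P-in : All (SupportedIn (Span (y ∷ L))) P
        P-in = All.map proj₂ (++⁻ˡ P new-edges)
        Q-in : All (SupportedIn (Span (y ∷ L))) Q
        Q-in = All.map proj₂ (++⁻ʳ P new-edges)
        π : Perm n
        π = flip (⨀ P) ∘ₚ (σ ∘ₚ flip (⨀ Q))
        π-in : SupportedIn (Span (y ∷ L)) π
        π-in = supported-∘ₚ (supported-flip (supported-⨀ P-in)) (supported-∘ₚ σ-in (supported-flip (supported-⨀ Q-in)))
        π-fixes-y : π ⟨$⟩ʳ y ≡ y
        π-fixes-y = begin
          ⨀ Q ⟨$⟩ˡ (σ ⟨$⟩ʳ (⨀ P ⟨$⟩ˡ y))  ≡⟨ cong (λ k → ⨀ Q ⟨$⟩ˡ (σ ⟨$⟩ʳ (⨀ P ⟨$⟩ˡ k))) (sym Pz≡y) ⟩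
          ⨀ Q ⟨$⟩ˡ (σ ⟨$⟩ʳ (⨀ P ⟨$⟩ˡ (⨀ P ⟨$⟩ʳ z))) ≡⟨ cong (λ k → ⨀ Q ⟨$⟩ˡ (σ ⟨$⟩ʳ k)) (inverseˡ (⨀ P)) ⟩
          ⨀ Q ⟨$⟩ˡ (σ ⟨$⟩ʳ z)            ≡⟨ cong (⨀ Q ⟨$⟩ˡ_) σz≡Qy ⟩
          ⨀ Q ⟨$⟩ˡ (⨀ Q ⟨$⟩ʳ y)          ≡⟨ inverseˡ (⨀ Q) ⟩
          y                              ∎
          where open ≡-Reasoning
        -- P and Q hold two transpositions in all, hence have the same parity
        π-odd : Par π ≡ true
        π-odd = begin
          Par π                                        ≡⟨ trans (Par-hom (flip (⨀ P)) _) (cong (Par (flip (⨀ P)) xor_) (Par-hom σ (flip (⨀ Q)))) ⟩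
          Par (flip (⨀ P)) xor (Par σ xor Par (flip (⨀ Q)))
            ≡⟨ cong₂ (λ p q → p xor (Par σ xor q)) (trans (Par-flip (⨀ P)) (Par-⨀ P-T)) (trans (Par-flip (⨀ Q)) (Par-⨀ Q-T)) ⟩
          parity (length P) xor (Par σ xor parity (length Q)) ≡⟨ cong (λ c → parity (length P) xor (c xor parity (length Q))) σ-odd ⟩
          parity (length P) xor (true xor parity (length Q))  ≡⟨ odd-middle (parity (length P)) (parity (length Q)) equal-parity ⟩
          true                                         ∎
          where
          open ≡-Reasoning
          P-T : All IsTransposition P
          P-T = All.map proj₁ (++⁻ˡ P new-edges)
          Q-T : All IsTransposition Q
          Q-T = All.map proj₁ (++⁻ʳ P new-edges)
          equal-parity : parity (length P) xor parity (length Q) ≡ false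
          equal-parity = trans (sym (parity-+ (length P) (length Q))) (cong parity (trans (sym (length-++ P)) (↭-length PQ↭)))
          odd-middle : ∀ p q → p xor q ≡ false → p xor (true xor q) ≡ true
          odd-middle false false _ = refl
          odd-middle true true _ = refl
        rearrange : ∀ {r} → r ↭ Edges L → P ++ r ++ Q ↭ Edges (y ∷ L)
        rearrange {r} r↭ = begin
          P ++ r ++ Q     ↭⟨ ++⁺ˡ P (++-comm r Q) ⟩
          P ++ Q ++ r     ≡⟨ ++-assoc P Q r ⟨
          (P ++ Q) ++ r   ↭⟨ ++⁺ʳ r PQ↭ ⟩
          uy ∷ vy ∷ r     ↭⟨ extend r↭ ⟩
          Edges (y ∷ L)   ∎
          where open PermutationReasoning
        conjugate : ∀ k → ⨀ Q ⟨$⟩ʳ (π ⟨$⟩ʳ (⨀ P ⟨$⟩ʳ k)) ≡ σ ⟨$⟩ʳ k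
        conjugate k = trans (cong (λ m → ⨀ Q ⟨$⟩ʳ (⨀ Q ⟨$⟩ˡ (σ ⟨$⟩ʳ m))) (inverseˡ (⨀ P))) (inverseʳ (⨀ Q))

        sandwich : ∀ x → x ∈ Span (y ∷ L) → (⨀ P ⟨$⟩ʳ x ≡ y → x ≡ v ⊎ σ ⟨$⟩ʳ x ≡ v) → Run (Edges (y ∷ L)) σ x
        sandwich x x∈ Px≡y→ with ⨀ P ⟨$⟩ʳ x ≟ y
        ... | yes Px≡y = frame P Q rearrange conjugate (claim-at π-in π-fixes-y π-odd u (here refl)) x (inj₂ (Px≡y→ Px≡y))
        ... | no Px≢y = frame P Q rearrange conjugate (claim-at π-in π-fixes-y π-odd _ Px∈) x (inj₁ refl)
          where
          Px∈ : ⨀ P ⟨$⟩ʳ x ∈ Span L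
          Px∈ = shrink (supported-preserves (supported-⨀ P-in) x∈) Px≢y

      -- The five sandwich arrangements follow; in each, P is injective, so z is
      -- the only point that P carries to y.
      P-injective : (P : List (Perm n)) → ∀ {x z} → ⨀ P ⟨$⟩ʳ x ≡ y → ⨀ P ⟨$⟩ʳ z ≡ y → x ≡ z
      P-injective P Px≡y Pz≡y = ⟨$⟩ʳ-injective (⨀ P) (trans Px≡y (sym Pz≡y))

      v↦y : σ ⟨$⟩ʳ v ≡ y → ∀ x → x ∈ Span (y ∷ L) → Run (Edges (y ∷ L)) σ x
      v↦y σv≡y x x∈ = Sandwich.sandwich (uy ∷ vy ∷ []) [] ↭-refl v v↦ σv≡y x x∈ λ Px≡y → inj₁ (P-injective (uy ∷ vy ∷ []) Px≡y v↦)
        where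
        v↦ : ⨀ (uy ∷ vy ∷ []) ⟨$⟩ʳ v ≡ y
        v↦ = trans (cong (vy ⟨$⟩ʳ_) (⟨⇄⟩-other u y (≢-sym u≢v) (≢-sym y≢v))) (⟨⇄⟩-left v y)

      u↦y : σ ⟨$⟩ʳ u ≡ y → ∀ x → x ∈ Span (y ∷ L) → x ≢ u → Run (Edges (y ∷ L)) σ x
      u↦y σu≡y x x∈ x≢u = Sandwich.sandwich (vy ∷ uy ∷ []) [] (swap vy uy ↭-refl) u u↦ σu≡y x x∈
        λ Px≡y → ⊥-elim (x≢u (P-injective (vy ∷ uy ∷ []) Px≡y u↦))
        where
        u↦ : ⨀ (vy ∷ uy ∷ []) ⟨$⟩ʳ u ≡ y
        u↦ = trans (cong (uy ⟨$⟩ʳ_) (⟨⇄⟩-other v y u≢v (≢-sym y≢u))) (⟨⇄⟩-left u y)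

      y↦u : σ ⟨$⟩ʳ y ≡ u → ∀ x → x ∈ Span (y ∷ L) → x ≢ y → Run (Edges (y ∷ L)) σ x
      y↦u σy≡u x x∈ x≢y = Sandwich.sandwich [] (uy ∷ vy ∷ []) ↭-refl y refl (trans σy≡u (sym y↦)) x x∈ (⊥-elim ∘ x≢y)
        where
        y↦ : ⨀ (uy ∷ vy ∷ []) ⟨$⟩ʳ y ≡ u
        y↦ = trans (cong (vy ⟨$⟩ʳ_) (⟨⇄⟩-right u y)) (⟨⇄⟩-other v y u≢v (≢-sym y≢u))

      u↦v : σ ⟨$⟩ʳ u ≡ v → ∀ x → x ∈ Span (y ∷ L) → Run (Edges (y ∷ L)) σ x
      u↦v σu≡v x x∈ = Sandwich.sandwich (uy ∷ []) (vy ∷ []) ↭-refl u (⟨⇄⟩-left u y) (trans σu≡v (sym (⟨⇄⟩-right v y))) x x∈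
        λ Px≡y → inj₂ (subst (λ k → σ ⟨$⟩ʳ k ≡ v) (sym (P-injective (uy ∷ []) Px≡y (⟨⇄⟩-left u y))) σu≡v)

      v↦u : σ ⟨$⟩ʳ v ≡ u → ∀ x → x ∈ Span (y ∷ L) → Run (Edges (y ∷ L)) σ x
      v↦u σv≡u x x∈ = Sandwich.sandwich (vy ∷ []) (uy ∷ []) (swap vy uy ↭-refl) v (⟨⇄⟩-left v y) (trans σv≡u (sym (⟨⇄⟩-right u y))) x x∈
        λ Px≡y → inj₁ (P-injective (vy ∷ []) Px≡y (⟨⇄⟩-left v y))

      triangle : ∀ k → ⨀ (uy ∷ uv ∷ vy ∷ []) ⟨$⟩ʳ k ≡ uv ⟨$⟩ʳ k
      triangle k with k ≟ u | k ≟ v | k ≟ y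
      ... | yes refl | _ | _ = begin
        vy ⟨$⟩ʳ (uv ⟨$⟩ʳ (uy ⟨$⟩ʳ u)) ≡⟨ cong (λ m → vy ⟨$⟩ʳ (uv ⟨$⟩ʳ m)) (⟨⇄⟩-left u y) ⟩
        vy ⟨$⟩ʳ (uv ⟨$⟩ʳ y)           ≡⟨ cong (vy ⟨$⟩ʳ_) (⟨⇄⟩-other u v y≢u y≢v) ⟩
        vy ⟨$⟩ʳ y                     ≡⟨ ⟨⇄⟩-right v y ⟩
        v                             ≡⟨ ⟨⇄⟩-left u v ⟨
        uv ⟨$⟩ʳ u                     ∎
        where open ≡-Reasoning
      ... | no _ | yes refl | _ = begin
        vy ⟨$⟩ʳ (uv ⟨$⟩ʳ (uy ⟨$⟩ʳ v)) ≡⟨ cong (λ m → vy ⟨$⟩ʳ (uv ⟨$⟩ʳ m)) (⟨⇄⟩-other u y (≢-sym u≢v) (≢-sym y≢v)) ⟩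
        vy ⟨$⟩ʳ (uv ⟨$⟩ʳ v)           ≡⟨ cong (vy ⟨$⟩ʳ_) (⟨⇄⟩-right u v) ⟩
        vy ⟨$⟩ʳ u                     ≡⟨ ⟨⇄⟩-other v y u≢v (≢-sym y≢u) ⟩
        u                             ≡⟨ ⟨⇄⟩-right u v ⟨
        uv ⟨$⟩ʳ v                     ∎
        where open ≡-Reasoning
      ... | no _ | no _ | yes refl = begin
        vy ⟨$⟩ʳ (uv ⟨$⟩ʳ (uy ⟨$⟩ʳ y)) ≡⟨ cong (λ m → vy ⟨$⟩ʳ (uv ⟨$⟩ʳ m)) (⟨⇄⟩-right u y) ⟩
        vy ⟨$⟩ʳ (uv ⟨$⟩ʳ u)           ≡⟨ cong (vy ⟨$⟩ʳ_) (⟨⇄⟩-left u v) ⟩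
        vy ⟨$⟩ʳ v                     ≡⟨ ⟨⇄⟩-left v y ⟩
        y                             ≡⟨ ⟨⇄⟩-other u v y≢u y≢v ⟨
        uv ⟨$⟩ʳ y                     ∎
        where open ≡-Reasoning
      ... | no k≢u | no k≢v | no k≢y =
        trans (cong (λ m → vy ⟨$⟩ʳ (uv ⟨$⟩ʳ m)) (⟨⇄⟩-other u y k≢u k≢y))
              (trans (cong (vy ⟨$⟩ʳ_) (⟨⇄⟩-other u v k≢u k≢v)) (trans (⟨⇄⟩-other v y k≢v k≢y) (sym (⟨⇄⟩-other u v k≢u k≢v))))

      expand-↭ : ∀ γ δ → γ ++ uv ∷ δ ↭ Edges L → γ ++ uy ∷ uv ∷ vy ∷ δ ↭ Edges (y ∷ L)
      expand-↭ γ δ old↭ = ↭-trans (++⁺ˡ γ (prep uy (swap uv vy ↭-refl))) (↭-trans (shifts γ (uy ∷ vy ∷ [])) (extend old↭))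

      expand-⨀ : ∀ γ δ → ⨀ (γ ++ uy ∷ uv ∷ vy ∷ δ) ≈ ⨀ (γ ++ uv ∷ δ)
      expand-⨀ γ δ k = trans (⨀-++ γ _ k) (trans (cong (⨀ δ ⟨$⟩ʳ_) (triangle (⨀ γ ⟨$⟩ʳ k))) (sym (⨀-++ γ (uv ∷ δ) k)))

      -- σ y = y : expand the hub edge of an old order of σ.
      fixed : σ ⟨$⟩ʳ y ≡ y → ∀ x → x ∈ Span (y ∷ L) → Run (Edges (y ∷ L)) σ x
      fixed σy≡y x x∈ with x ≟ y
      ... | yes refl = visit-y (claim-at σ-in σy≡y σ-odd u (here refl))
        where
        visit-y : Run (Edges L) σ u → Run (Edges (y ∷ L)) σ y
        visit-y (run r r↭ ⨀r≈σ _ _ _ _) with ∈-∃++ (∈-resp-↭ (↭-sym r↭) (here refl))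
        ... | γ , δ , refl = run (γ ++ uy ∷ uv ∷ vy ∷ δ) (expand-↭ γ δ r↭) (λ k → trans (expand-⨀ γ δ k) (⨀r≈σ k))
                                 (γ ++ uy ∷ uv ∷ []) (vy ∷ δ) (sym (++-assoc γ (uy ∷ uv ∷ []) (vy ∷ δ))) visits
          where
          visits : ⨀ (γ ++ uy ∷ uv ∷ []) ⟨$⟩ʳ y ≡ v
          visits = trans (⨀-++ γ (uy ∷ uv ∷ []) y)
                         (trans (cong (λ m → uv ⟨$⟩ʳ (uy ⟨$⟩ʳ m)) (prefix-fixes-y {α = γ} {uv ∷ δ} r↭ refl))
                                (trans (cong (uv ⟨$⟩ʳ_) (⟨⇄⟩-right u y)) (⟨⇄⟩-left u v)))
      ... | no x≢y = keep-visit (claim-at σ-in σy≡y σ-odd x (shrink x∈ x≢y))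
        where
        -- the old visiting prefix, expanded if it contains uv, still carries x to v
        keep-visit : Run (Edges L) σ x → Run (Edges (y ∷ L)) σ x
        keep-visit (run r r↭ ⨀r≈σ α β refl αx≡v) with ∈-++⁻ α (∈-resp-↭ (↭-sym r↭) (here refl))
        ... | inj₁ uv∈α with ∈-∃++ uv∈α
        ...   | γ , γ′ , refl rewrite ++-assoc γ (uv ∷ γ′) β =
          run (γ ++ uy ∷ uv ∷ vy ∷ γ′ ++ β) (expand-↭ γ (γ′ ++ β) r↭) (λ k → trans (expand-⨀ γ (γ′ ++ β) k) (⨀r≈σ k))
              (γ ++ uy ∷ uv ∷ vy ∷ γ′) β (sym (++-assoc γ (uy ∷ uv ∷ vy ∷ γ′) β)) (trans (expand-⨀ γ γ′ x) αx≡v)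
        keep-visit (run r r↭ ⨀r≈σ α β refl αx≡v) | inj₂ uv∈β with ∈-∃++ uv∈β
        ... | γ , δ , refl rewrite sym (++-assoc α γ (uv ∷ δ)) =
          run ((α ++ γ) ++ uy ∷ uv ∷ vy ∷ δ) (expand-↭ (α ++ γ) δ r↭) (λ k → trans (expand-⨀ (α ++ γ) δ k) (⨀r≈σ k))
              α (γ ++ uy ∷ uv ∷ vy ∷ δ) (++-assoc α γ _) αx≡v

      -- σ z = y for an old vertex z ≠ u: put uy first and insert vy into an old
      -- order right after a prefix α carrying z to v.  Moved across α, the edge
      -- vy becomes the transposition of z and y, so the product is uy (z y) π
      -- with π = (z y) uy σ, a permutation of the old vertices.
      middle : ∀ z → z ∈ Span (y ∷ L) → z ≢ u → z ≢ y → σ ⟨$⟩ʳ z ≡ y →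
        ∀ x → x ≡ u ⊎ x ≡ v ⊎ x ≡ z → Run (Edges (y ∷ L)) σ x
      middle z z∈ z≢u z≢y σz≡y x which = build (claim-at π-in π-fixes-y π-odd z (shrink z∈ z≢y))
        where
        zy π : Perm n
        zy = ⟨ z ⇄ y ⟩
        π = zy ∘ₚ (uy ∘ₚ σ)
        π-in : SupportedIn (Span (y ∷ L)) π
        π-in = supported-∘ₚ (supported-⟨⇄⟩ z∈ y∈) (supported-∘ₚ (supported-⟨⇄⟩ u∈ y∈) σ-in)
        π-fixes-y : π ⟨$⟩ʳ y ≡ y
        π-fixes-y = trans (cong (λ m → σ ⟨$⟩ʳ (uy ⟨$⟩ʳ m)) (⟨⇄⟩-right z y))
                          (trans (cong (σ ⟨$⟩ʳ_) (⟨⇄⟩-other u y z≢u z≢y)) σz≡y)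
        π-odd : Par π ≡ true
        π-odd = trans (Par-hom zy (uy ∘ₚ σ)) (cong₂ _xor_ (Par-⟨⇄⟩ z≢y) (trans (Par-hom uy σ) (cong₂ _xor_ (Par-⟨⇄⟩ (≢-sym y≢u)) σ-odd)))
        build : Run (Edges L) π z → Run (Edges (y ∷ L)) σ x
        build (run r r↭ ⨀r≈π α β refl αz≡v) = visiting which
          where
          A : Fin n → Fin n
          A m = ⨀ α ⟨$⟩ʳ m
          αy≡y : A y ≡ y
          αy≡y = prefix-fixes-y {α = α} {β} r↭ refl
          slide : ∀ m → vy ⟨$⟩ʳ A m ≡ A (zy ⟨$⟩ʳ m)
          slide m = begin
            vy ⟨$⟩ʳ A m             ≡⟨ ⟨⇄⟩-action v y (A m) ⟩
            (v ⇄ y) (A m)           ≡⟨ cong₂ (λ p q → (p ⇄ q) (A m)) (sym αz≡v) (sym αy≡y) ⟩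
            (A z ⇄ A y) (A m)       ≡⟨ ⇄-conjugate (⨀ α) z y m ⟩
            A ((z ⇄ y) m)           ≡⟨ cong A (⟨⇄⟩-action z y m) ⟨
            A (zy ⟨$⟩ʳ m)           ∎
            where open ≡-Reasoning
          product : ⨀ (uy ∷ α ++ vy ∷ β) ≈ σ
          product k = begin
            ⨀ (α ++ vy ∷ β) ⟨$⟩ʳ (uy ⟨$⟩ʳ k)            ≡⟨ ⨀-++ α (vy ∷ β) _ ⟩
            ⨀ β ⟨$⟩ʳ (vy ⟨$⟩ʳ A (uy ⟨$⟩ʳ k))             ≡⟨ cong (⨀ β ⟨$⟩ʳ_) (slide _) ⟩
            ⨀ β ⟨$⟩ʳ A (zy ⟨$⟩ʳ (uy ⟨$⟩ʳ k))             ≡⟨ ⨀-++ α β _ ⟨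
            ⨀ (α ++ β) ⟨$⟩ʳ (zy ⟨$⟩ʳ (uy ⟨$⟩ʳ k))        ≡⟨ ⨀r≈π _ ⟩
            σ ⟨$⟩ʳ (uy ⟨$⟩ʳ (zy ⟨$⟩ʳ (zy ⟨$⟩ʳ (uy ⟨$⟩ʳ k)))) ≡⟨ cong (λ m → σ ⟨$⟩ʳ (uy ⟨$⟩ʳ m)) (involution (≢-sym z≢y) _) ⟩
            σ ⟨$⟩ʳ (uy ⟨$⟩ʳ (uy ⟨$⟩ʳ k))                 ≡⟨ cong (σ ⟨$⟩ʳ_) (involution y≢u k) ⟩
            σ ⟨$⟩ʳ k                                    ∎
            where
            open ≡-Reasoning
            involution : ∀ {a} → y ≢ a → ∀ m → ⟨ a ⇄ y ⟩ ⟨$⟩ʳ (⟨ a ⇄ y ⟩ ⟨$⟩ʳ m) ≡ m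
            involution y≢a = transposition-involutive (⟨⇄⟩-IsTransposition (≢-sym y≢a))
          rearranges : uy ∷ α ++ vy ∷ β ↭ Edges (y ∷ L)
          rearranges = ↭-trans (prep uy (shift vy α β)) (extend r↭)
          visiting : x ≡ u ⊎ x ≡ v ⊎ x ≡ z → Run (Edges (y ∷ L)) σ x
          visiting (inj₁ refl) =
            run _ rearranges product (uy ∷ α ++ vy ∷ []) β (cong (uy ∷_) (sym (++-assoc α (vy ∷ []) β)))
                (trans (⨀-++ α (vy ∷ []) (uy ⟨$⟩ʳ u)) (trans (cong (λ m → vy ⟨$⟩ʳ A m) (⟨⇄⟩-left u y))
                       (trans (cong (vy ⟨$⟩ʳ_) αy≡y) (⟨⇄⟩-right v y))))
          visiting (inj₂ (inj₁ refl)) = run-from-v rearranges product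
          visiting (inj₂ (inj₂ refl)) =
            run _ rearranges product (uy ∷ α) (vy ∷ β) refl (trans (cong A (⟨⇄⟩-other u y z≢u z≢y)) αz≡v)

    Span-↭ : {M M′ : List (Fin n)} → M ↭ M′ → Span M ↭ Span M′
    Span-↭ M↭M′ = prep u (prep v M↭M′)

    -- The inductive step for the leaves M = y₀ ∷ M₀, given the claim for all
    -- sets of k leaves: the leaf treated as the newest one is chosen according
    -- to σ and to the vertex x to be visited.
    module NewestLeaf (k : ℕ) (y₀ : Fin n) (M₀ : List (Fin n)) (|M|≡1+k : length (y₀ ∷ M₀) ≡ suc k)
                      (claim-k : ∀ L → length L ≡ k → Claim L) (unique-M : Unique (Span (y₀ ∷ M₀)))
                      (σ : Perm n) (σ-in : SupportedIn (Span (y₀ ∷ M₀)) σ) (σ-odd : Par σ ≡ true) where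
      open import Data.List.Relation.Binary.Permutation.Setoid.Properties (setoid (Fin n)) using (Unique-resp-↭)
      open import Data.List.Relation.Binary.Permutation.Propositional using (↭⇒↭ₛ)

      M : List (Fin n)
      M = y₀ ∷ M₀

      toSpan : ∀ {y L k} → M ↭ y ∷ L → k ∈ Span M → k ∈ Span (y ∷ L)
      toSpan M↭ = ∈-resp-↭ (Span-↭ M↭)
      unique′ : ∀ {y L} → M ↭ y ∷ L → Unique (Span (y ∷ L))
      unique′ M↭ = Unique-resp-↭ (↭⇒↭ₛ (Span-↭ M↭)) unique-M
      shorter : ∀ {y L} → M ↭ y ∷ L → length L ≡ k
      shorter M↭ = suc-injective (trans (sym (↭-length M↭)) |M|≡1+k)
      σ-in′ : ∀ {y L} → M ↭ y ∷ L → SupportedIn (Span (y ∷ L)) σ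
      σ-in′ M↭ = supported λ k k∉ → fixes-outside σ-in k (k∉ ∘ toSpan M↭)

      module As-newest {y L} (M↭ : M ↭ y ∷ L) =
        Step y L (unique′ M↭) (claim-k L (shorter M↭)) σ (σ-in′ M↭) σ-odd

      via : ∀ {y z} → y ∈ M → (∀ {L} → M ↭ y ∷ L → Run (Edges (y ∷ L)) σ z) → Run (Edges M) σ z
      via y∈M use with ∈-∃++ y∈M
      ... | ys , zs , M≡ = Run-resp-↭ (prep _ (leafEdges-↭ (↭-sym M↭))) (use M↭)
        where
        M↭ : M ↭ _ ∷ ys ++ zs
        M↭ = subst (_↭ _ ∷ ys ++ zs) (sym M≡) (shift _ ys zs)

      hubs-not-leaves : All (u ≢_) M × All (v ≢_) M
      hubs-not-leaves = unpack unique-M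
        where
        unpack : Unique (Span M) → All (u ≢_) M × All (v ≢_) M
        unpack ((_ ∷ u∉M) ∷ v∉M ∷ _) = u∉M , v∉M
      leaf≢u : ∀ {w} → w ∈ M → w ≢ u
      leaf≢u w∈M = ≢-sym (All.lookup (proj₁ hubs-not-leaves) w∈M)
      leaf≢v : ∀ {w} → w ∈ M → w ≢ v
      leaf≢v w∈M = ≢-sym (All.lookup (proj₂ hubs-not-leaves) w∈M)

      σ-preserves : ∀ {k} → k ∈ Span M → σ ⟨$⟩ʳ k ∈ Span M
      σ-preserves = supported-preserves σ-in

      leaf : ∀ {k} → k ∈ Span M → k ≢ u → k ≢ v → k ∈ M
      leaf (here k≡u) k≢u _ = ⊥-elim (k≢u k≡u)
      leaf (there (here k≡v)) _ k≢v = ⊥-elim (k≢v k≡v)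
      leaf (there (there k∈M)) _ _ = k∈M

      u∈ : u ∈ Span M
      u∈ = here refl

      -- When σ maps neither hub to the other, the newest leaf is found by
      -- following σ from x (from u when x is a hub).
      module HubsNotSwapped (σu≢v : σ ⟨$⟩ʳ u ≢ v) (σv≢u : σ ⟨$⟩ʳ v ≢ u) where
        -- if σ v ≠ v then σ v is a leaf y, and σ v = y is a sandwich case
        via-σv : σ ⟨$⟩ʳ v ≢ v → ∀ {z} → z ∈ Span M → Run (Edges M) σ z
        via-σv σv≢v {z} z∈ =
          via (leaf (σ-preserves (there (here refl))) σv≢u σv≢v) λ M↭ → As-newest.v↦y M↭ refl z (toSpan M↭ z∈)

        -- σ fixes u: take the preimage z of the first leaf y₀
        u-fixed : σ ⟨$⟩ʳ u ≡ u → Run (Edges M) σ u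
        u-fixed σu≡u with σ ⟨$⟩ˡ y₀ ≟ y₀
        ... | yes z≡y₀ = via (here refl) λ M↭ → As-newest.fixed M↭ σy₀≡y₀ u (toSpan M↭ u∈)
          where
          σy₀≡y₀ : σ ⟨$⟩ʳ y₀ ≡ y₀
          σy₀≡y₀ = trans (cong (σ ⟨$⟩ʳ_) (sym z≡y₀)) (inverseʳ σ)
        ... | no z≢y₀ = via (here refl) λ M↭ → As-newest.middle M↭ z (toSpan M↭ z∈) z≢u z≢y₀ (inverseʳ σ) u (inj₁ refl)
          where
          z : Fin n
          z = σ ⟨$⟩ˡ y₀
          z∈ : z ∈ Span M
          z∈ = supported-reflects σ-in (subst (_∈ Span M) (sym (inverseʳ σ)) (there (there (here refl))))
          z≢u : z ≢ u
          z≢u z≡u = leaf≢u (here refl) (trans (sym (inverseʳ σ)) (trans (cong (σ ⟨$⟩ʳ_) z≡u) σu≡u))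

        -- σ u = w is a leaf: look one step further, at σ w
        u-moved : σ ⟨$⟩ʳ u ∈ M → Run (Edges M) σ u
        u-moved w∈M with σ-preserves (there (there w∈M))
        ... | here σw≡u = via w∈M λ M↭ → As-newest.y↦u M↭ σw≡u u (toSpan M↭ u∈) (≢-sym (leaf≢u w∈M))
        ... | there (here σw≡v) = via-σv (λ σv≡v → leaf≢v w∈M (⟨$⟩ʳ-injective σ (trans σw≡v (sym σv≡v)))) u∈
        ... | there (there σw∈M) =
          via σw∈M λ M↭ → As-newest.middle M↭ _ (toSpan M↭ (there (there w∈M))) (leaf≢u w∈M) w≢σw refl u (inj₁ refl)
          where
          w≢σw : σ ⟨$⟩ʳ u ≢ σ ⟨$⟩ʳ (σ ⟨$⟩ʳ u)
          w≢σw e = leaf≢u w∈M (sym (⟨$⟩ʳ-injective σ e))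

        visit-u : Run (Edges M) σ u
        visit-u with σ-preserves u∈
        ... | here σu≡u = u-fixed σu≡u
        ... | there (here σu≡v) = ⊥-elim (σu≢v σu≡v)
        ... | there (there σu∈M) = u-moved σu∈M

        -- x = w is a leaf: follow σ from w
        visit-leaf : ∀ {w} → w ∈ M → Run (Edges M) σ w
        visit-leaf {w} w∈M with σ-preserves (there (there w∈M))
        ... | here σw≡u = via σu∈M λ M↭ → As-newest.u↦y M↭ refl w (toSpan M↭ (there (there w∈M))) (leaf≢u w∈M)
          where
          σu∈M : σ ⟨$⟩ʳ u ∈ M
          σu∈M = leaf (σ-preserves u∈) (λ σu≡u → leaf≢u w∈M (⟨$⟩ʳ-injective σ (trans σw≡u (sym σu≡u)))) σu≢v
        ... | there (here σw≡v) = via-σv (λ σv≡v → leaf≢v w∈M (⟨$⟩ʳ-injective σ (trans σw≡v (sym σv≡v)))) (there (there w∈M))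
        ... | there (there σw∈M) with σ ⟨$⟩ʳ w ≟ w
        ...   | yes σw≡w = via w∈M λ M↭ → As-newest.fixed M↭ σw≡w w (toSpan M↭ (there (there w∈M)))
        ...   | no σw≢w = via σw∈M λ M↭ →
          As-newest.middle M↭ w (toSpan M↭ (there (there w∈M))) (leaf≢u w∈M) (≢-sym σw≢w) refl w (inj₂ (inj₂ refl))

        by-vertex : ∀ {x} → x ∈ Span M → Run (Edges M) σ x
        by-vertex (here x≡u) = subst (Run (Edges M) σ) (sym x≡u) visit-u
        by-vertex (there (here x≡v)) = subst (Run (Edges M) σ) (sym x≡v) (Run-at-v visit-u)
        by-vertex (there (there x∈M)) = visit-leaf x∈M

      -- If σ maps a hub to the other one, a sandwich handles every x.
      choose : ∀ x → x ∈ Span M → Run (Edges M) σ x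
      choose x x∈ with σ ⟨$⟩ʳ u ≟ v | σ ⟨$⟩ʳ v ≟ u
      ... | yes σu≡v | _ = via (here refl) λ M↭ → As-newest.u↦v M↭ σu≡v x (toSpan M↭ x∈)
      ... | no _ | yes σv≡u = via (here refl) λ M↭ → As-newest.v↦u M↭ σv≡u x (toSpan M↭ x∈)
      ... | no σu≢v | no σv≢u = HubsNotSwapped.by-vertex σu≢v σv≢u x∈

    claim : ∀ k M → length M ≡ k → Claim M
    claim zero [] _ = claim-[]
    claim (suc k) (y₀ ∷ M₀) |M|≡1+k unique-M σ σ-in σ-odd = NewestLeaf.choose k y₀ M₀ |M|≡1+k (claim k) unique-M σ σ-in σ-odd

    Edges-odd : (L : List (Fin n)) → parity (length (Edges L)) ≡ true
    Edges-odd [] = refl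
    Edges-odd (y ∷ L) = trans (not-involutive _) (Edges-odd L)

    Edges-cover : (L : List (Fin n)) → Unique (Span L) → (∀ k → k ∈ Span L) → Covers (Edges L) true
    Edges-cover L unique-L spanning σ σ-odd
      with claim (length L) L refl unique-L σ (supported λ k k∉ → ⊥-elim (k∉ (spanning k))) σ-odd u (here refl)
    ... | run order order↭ ⨀≈σ _ _ _ _ = order , order↭ , ⨀≈σ

module EdgeLists where

  open import Defs using (SimpleGraph; adj; Central; edgeTranspositions)
  open Swaps
  open Arrangements using (IsTransposition; swaps)
  open DoubleStars using (module DoubleStar)
  open Sign using (<ᵇ-flip; <ᵇ-irrefl)
  open import Data.Nat using (ℕ)
  open import Data.Bool using (Bool; true; false; not; _∧_; if_then_else_)
  import Data.Bool.Properties as Bool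
  open import Data.Empty using (⊥-elim)
  open import Data.Fin using (Fin)
  open import Data.Fin.Properties using (_≟_; _<?_; <-cmp)
  open import Data.Fin.Permutation using (Permutation′; transpose)
  open import Data.List using (List; []; _∷_; _++_; map; filter; concatMap; cartesianProduct; allFin)
  open import Data.List.Properties using (map-++; filter-++)
  open import Data.List.Membership.Propositional using (_∈_)
  open import Data.List.Membership.Propositional.Properties using (∈-filter⁺; ∈-filter⁻; ∈-allFin; ∈-cartesianProduct⁺; ∈-++⁻; ∈-++⁺ˡ; ∈-++⁺ʳ)
  open import Data.List.Relation.Unary.Any using (here; there)
  open import Data.List.Relation.Unary.All as All using (All; []; _∷_)
  import Data.List.Relation.Unary.All.Properties as All
  open import Data.List.Relation.Unary.Unique.Propositional using (Unique)
  open import Data.List.Relation.Unary.AllPairs using ([]; _∷_)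
  open import Data.List.Relation.Unary.Unique.Propositional.Properties using (filter⁺; allFin⁺; cartesianProduct⁺; ++⁺)
  open import Data.List.Relation.Binary.Permutation.Propositional using (_↭_; module PermutationReasoning)
  open import Data.List.Relation.Binary.Permutation.Propositional.Properties using (map⁺; ++-comm)
  open import Data.List.Relation.Binary.BagAndSetEquality using (∼bag⇒↭)
  open import Data.List.Membership.Propositional.Properties.WithK using (unique∧set⇒bag)
  open import Data.List.Relation.Binary.Disjoint.Propositional using (Disjoint)
  open import Function.Bundles using (mk⇔)
  open import Data.Product using (Σ; _×_; _,_; proj₁; proj₂; uncurry)
  open import Data.Product.Properties using (,-injectiveˡ; ,-injectiveʳ)
  open import Data.Sum using (_⊎_; inj₁; inj₂)
  open import Relation.Nullary using (¬_; Dec; does; yes; no; ¬?; _⊎-dec_)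
  open import Relation.Nullary.Decidable using (dec-true; dec-false)
  open import Relation.Binary using (tri<; tri≈; tri>)
  open import Relation.Binary.PropositionalEquality
  open import Function using (_∘_)

  private variable n : ℕ

  concatMap-pairs : {A B C : Set} (c : A → B → Bool) (f : A → B → C) (xs : List A) (ys : List B) →
    concatMap (λ i → concatMap (λ j → if c i j then f i j ∷ [] else []) ys) xs
      ≡ map (uncurry f) (filter (λ p → uncurry c p Bool.≟ true) (cartesianProduct xs ys))
  concatMap-pairs c f [] ys = refl
  concatMap-pairs {A} {B} {C} c f (x ∷ xs) ys = begin
    row ys ++ concatMap (λ i → concatMap (λ j → if c i j then f i j ∷ [] else []) ys) xs ≡⟨ cong₂ _++_ (row≡ ys) (concatMap-pairs c f xs ys) ⟩
    map (uncurry f) (filter P? (map (x ,_) ys)) ++ map (uncurry f) (filter P? (cartesianProduct xs ys))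
      ≡⟨ map-++ (uncurry f) (filter P? (map (x ,_) ys)) (filter P? (cartesianProduct xs ys)) ⟨
    map (uncurry f) (filter P? (map (x ,_) ys) ++ filter P? (cartesianProduct xs ys))
      ≡⟨ cong (map (uncurry f)) (filter-++ P? (map (x ,_) ys) (cartesianProduct xs ys)) ⟨
    map (uncurry f) (filter P? (map (x ,_) ys ++ cartesianProduct xs ys)) ∎
    where
    open ≡-Reasoning
    P? : (p : A × B) → Dec (uncurry c p ≡ true)
    P? p = uncurry c p Bool.≟ true
    row : List B → List C
    row ys′ = concatMap (λ j → if c x j then f x j ∷ [] else []) ys′
    row≡ : ∀ ys′ → row ys′ ≡ map (uncurry f) (filter P? (map (x ,_) ys′))
    row≡ [] = refl
    row≡ (y ∷ ys′) with c x y
    ... | true = cong (f x y ∷_) (row≡ ys′)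
    ... | false = row≡ ys′

  ordered : Fin n → Fin n → Fin n × Fin n
  ordered a b = if does (a <? b) then (a , b) else (b , a)

  tr : Fin n × Fin n → Permutation′ n
  tr = uncurry transpose

  tr-ordered : (a b : Fin n) → tr (ordered a b) ≡ ⟨ a ⇄ b ⟩
  tr-ordered a b with does (a <? b)
  ... | true = refl
  ... | false = refl

  ordered-sym : {a b : Fin n} → a ≢ b → ordered a b ≡ ordered b a
  ordered-sym {a = a} {b} a≢b with <-cmp a b
  ... | tri< a<b _ b≮a rewrite dec-true (a <? b) a<b | dec-false (b <? a) b≮a = refl
  ... | tri≈ _ a≡b _ = ⊥-elim (a≢b a≡b)
  ... | tri> a≮b _ b<a rewrite dec-false (a <? b) a≮b | dec-true (b <? a) b<a = refl

  ordered-< : {a b : Fin n} → does (a <? b) ≡ true → ordered a b ≡ (a , b)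
  ordered-< {a = a} {b} a<b rewrite a<b = refl

  ordered-injective : {a b c d : Fin n} → ordered a b ≡ ordered c d → (a ≡ c × b ≡ d) ⊎ (a ≡ d × b ≡ c)
  ordered-injective {a = a} {b} {c} {d} e with does (a <? b) | does (c <? d)
  ... | true | true = inj₁ (,-injectiveˡ e , ,-injectiveʳ e)
  ... | true | false = inj₂ (,-injectiveˡ e , ,-injectiveʳ e)
  ... | false | true = inj₂ (,-injectiveʳ e , ,-injectiveˡ e)
  ... | false | false = inj₁ (,-injectiveʳ e , ,-injectiveˡ e)

  module EdgeDecomposition {n} (G : SimpleGraph n) (u v : Fin n) (u≢v : u ≢ v)
                           (u-central : Central G u) (v-central : Central G v) where
    open DoubleStar u v u≢v using (Span; Edges; leafEdges)

    IsEdge : Fin n → Fin n → Bool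
    IsEdge i j = does (i <? j) ∧ adj G i j

    IsEdge? : (p : Fin n × Fin n) → Dec (uncurry IsEdge p ≡ true)
    IsEdge? p = uncurry IsEdge p Bool.≟ true

    allPairs edgePairs : List (Fin n × Fin n)
    allPairs = cartesianProduct (allFin n) (allFin n)
    edgePairs = filter IsEdge? allPairs

    edgePairs-tr : edgeTranspositions G ≡ map tr edgePairs
    edgePairs-tr = concatMap-pairs IsEdge transpose (allFin n) (allFin n)

    edgePairs-unique : Unique edgePairs
    edgePairs-unique = filter⁺ IsEdge? (cartesianProduct⁺ (allFin⁺ n) (allFin⁺ n))

    ∈-edgePairs⁻ : ∀ {i j} → (i , j) ∈ edgePairs → does (i <? j) ≡ true
    ∈-edgePairs⁻ {i} {j} ij∈ with does (i <? j) | proj₂ (∈-filter⁻ IsEdge? {xs = allPairs} ij∈)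
    ... | true | _ = refl
    ... | false | ()

    hub-edge : ∀ {h k} → Central G h → k ≢ h → ordered h k ∈ edgePairs
    hub-edge {h} {k} h-central k≢h with does (h <? k) in h<k
    ... | true = ∈-filter⁺ IsEdge? (∈-cartesianProduct⁺ (∈-allFin h) (∈-allFin k)) (cong₂ _∧_ h<k (h-central k k≢h))
    ... | false = ∈-filter⁺ IsEdge? (∈-cartesianProduct⁺ (∈-allFin k) (∈-allFin h))
                    (cong₂ _∧_ (trans (<ᵇ-flip (≢-sym k≢h)) (cong not h<k)) (trans (SimpleGraph.sym G k h) (h-central k k≢h)))

    edgePair-distinct : ∀ {i j} → (i , j) ∈ edgePairs → i ≢ j
    edgePair-distinct {i} ij∈ refl = Bool.not-¬ (<ᵇ-irrefl i) (∈-edgePairs⁻ ij∈)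

    edgePair-transposition : ∀ {p} → p ∈ edgePairs → IsTransposition (tr p)
    edgePair-transposition {i , j} ij∈ = swaps (edgePair-distinct ij∈) (λ _ → refl)

    IsHub : Fin n → Set
    IsHub k = k ≡ u ⊎ k ≡ v

    IsHub? : (k : Fin n) → Dec (IsHub k)
    IsHub? k = (k ≟ u) ⊎-dec (k ≟ v)

    leaves : List (Fin n)
    leaves = filter (¬? ∘ IsHub?) (allFin n)

    leaf-not-hub : ∀ {k} → k ∈ leaves → ¬ IsHub k
    leaf-not-hub k∈ = proj₂ (∈-filter⁻ (¬? ∘ IsHub?) {xs = allFin n} k∈)

    spanning : ∀ k → k ∈ Span leaves
    spanning k with IsHub? k
    ... | yes (inj₁ k≡u) = here k≡u
    ... | yes (inj₂ k≡v) = there (here k≡v)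
    ... | no k-leaf = there (there (∈-filter⁺ (¬? ∘ IsHub?) (∈-allFin k) k-leaf))

    Span-unique : Unique (Span leaves)
    Span-unique = (u≢v ∷ All.tabulate (λ k∈ u≡k → leaf-not-hub k∈ (inj₁ (sym u≡k))))
                ∷ All.tabulate (λ k∈ v≡k → leaf-not-hub k∈ (inj₂ (sym v≡k)))
                ∷ filter⁺ (¬? ∘ IsHub?) (allFin⁺ n)

    central : ∀ {h} → IsHub h → Central G h
    central (inj₁ refl) = u-central
    central (inj₂ refl) = v-central

    leafPairs : List (Fin n) → List (Fin n × Fin n)
    leafPairs [] = []
    leafPairs (y ∷ L) = ordered u y ∷ ordered v y ∷ leafPairs L

    hubPairs : List (Fin n × Fin n)
    hubPairs = ordered u v ∷ leafPairs leaves

    hubPairs-tr : map tr hubPairs ≡ Edges leaves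
    hubPairs-tr = cong₂ _∷_ (tr-ordered u v) (leafPairs-tr leaves)
      where
      leafPairs-tr : ∀ L → map tr (leafPairs L) ≡ leafEdges L
      leafPairs-tr [] = refl
      leafPairs-tr (y ∷ L) = cong₂ _∷_ (tr-ordered u y) (cong₂ _∷_ (tr-ordered v y) (leafPairs-tr L))

    ∈-leafPairs⁻ : ∀ {p L} → p ∈ leafPairs L → Σ (Fin n) λ h → Σ (Fin n) λ y → IsHub h × y ∈ L × p ≡ ordered h y
    ∈-leafPairs⁻ {L = y ∷ L} (here p≡) = u , y , inj₁ refl , here refl , p≡
    ∈-leafPairs⁻ {L = y ∷ L} (there (here p≡)) = v , y , inj₂ refl , here refl , p≡
    ∈-leafPairs⁻ {L = y ∷ L} (there (there p∈)) with ∈-leafPairs⁻ p∈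
    ... | h , z , h-hub , z∈L , p≡ = h , z , h-hub , there z∈L , p≡

    ∈-leafPairs⁺ : ∀ {h y L} → IsHub h → y ∈ L → ordered h y ∈ leafPairs L
    ∈-leafPairs⁺ (inj₁ refl) (here refl) = here refl
    ∈-leafPairs⁺ (inj₂ refl) (here refl) = there (here refl)
    ∈-leafPairs⁺ h-hub (there y∈L) = there (there (∈-leafPairs⁺ h-hub y∈L))

    Touches : Fin n × Fin n → Set
    Touches (i , j) = IsHub i ⊎ IsHub j

    Touches? : (p : Fin n × Fin n) → Dec (Touches p)
    Touches? (i , j) = IsHub? i ⊎-dec IsHub? j

    ordered-touching : ∀ {h k} → IsHub h → k ≢ h → ordered h k ∈ edgePairs × Touches (ordered h k)
    ordered-touching {h} {k} h-hub k≢h = hub-edge (central h-hub) k≢h , touching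
      where
      touching : Touches (ordered h k)
      touching with does (h <? k)
      ... | true = inj₁ h-hub
      ... | false = inj₂ h-hub

    ∈-hubPairs⁻ : ∀ {p} → p ∈ hubPairs → p ∈ edgePairs × Touches p
    ∈-hubPairs⁻ (here refl) = ordered-touching (inj₁ refl) (≢-sym u≢v)
    ∈-hubPairs⁻ (there p∈) with ∈-leafPairs⁻ p∈
    ... | h , y , h-hub , y∈ , refl = ordered-touching h-hub λ y≡h → leaf-not-hub y∈ (subst IsHub (sym y≡h) h-hub)

    ordered-hub : ∀ {h k} → IsHub h → k ≢ h → ordered h k ∈ hubPairs
    ordered-hub {h} {k} h-hub k≢h with IsHub? k
    ... | no k-leaf = there (∈-leafPairs⁺ h-hub (∈-filter⁺ (¬? ∘ IsHub?) (∈-allFin k) k-leaf))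
    ... | yes k-hub = here (hub-to-hub h-hub k-hub)
      where
      hub-to-hub : IsHub h → IsHub k → ordered h k ≡ ordered u v
      hub-to-hub (inj₁ refl) (inj₁ refl) = ⊥-elim (k≢h refl)
      hub-to-hub (inj₁ refl) (inj₂ refl) = refl
      hub-to-hub (inj₂ refl) (inj₁ refl) = ordered-sym (≢-sym u≢v)
      hub-to-hub (inj₂ refl) (inj₂ refl) = ⊥-elim (k≢h refl)

    ∈-hubPairs⁺ : ∀ {p} → p ∈ edgePairs → Touches p → p ∈ hubPairs
    ∈-hubPairs⁺ {i , j} ij∈ (inj₁ i-hub) =
      subst (_∈ hubPairs) (ordered-< (∈-edgePairs⁻ ij∈)) (ordered-hub i-hub (≢-sym (edgePair-distinct ij∈)))
    ∈-hubPairs⁺ {i , j} ij∈ (inj₂ j-hub) =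
      subst (_∈ hubPairs) (trans (ordered-sym (≢-sym (edgePair-distinct ij∈))) (ordered-< (∈-edgePairs⁻ ij∈)))
            (ordered-hub j-hub (edgePair-distinct ij∈))

    pair-match : ∀ {h h′ y z} → IsHub h → ¬ IsHub z → ordered h y ≡ ordered h′ z → h ≡ h′ × y ≡ z
    pair-match h-hub z-leaf e with ordered-injective e
    ... | inj₁ same = same
    ... | inj₂ (h≡z , _) = ⊥-elim (z-leaf (subst IsHub h≡z h-hub))

    leafPairs-unique : ∀ {L} → Unique L → All (¬_ ∘ IsHub) L → Unique (leafPairs L)
    leafPairs-unique [] [] = []
    leafPairs-unique {y ∷ L} (y∉L ∷ unique-L) (y-leaf ∷ L-leaves) =
      (uy≢vy ∷ All.tabulate (differs (inj₁ refl))) ∷ All.tabulate (differs (inj₂ refl)) ∷ leafPairs-unique unique-L L-leaves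
      where
      uy≢vy : ordered u y ≢ ordered v y
      uy≢vy e = u≢v (proj₁ (pair-match (inj₁ refl) y-leaf e))
      differs : ∀ {h} → IsHub h → ∀ {p} → p ∈ leafPairs L → ordered h y ≢ p
      differs h-hub p∈ e with ∈-leafPairs⁻ p∈
      ... | h′ , z , h′-hub , z∈L , refl = All.lookup y∉L z∈L (proj₂ (pair-match h-hub (All.lookup L-leaves z∈L) e))

    hubPairs-unique : Unique hubPairs
    hubPairs-unique = All.tabulate uv-differs ∷ leafPairs-unique (filter⁺ (¬? ∘ IsHub?) (allFin⁺ n)) (All.tabulate leaf-not-hub)
      where
      uv-differs : ∀ {p} → p ∈ leafPairs leaves → ordered u v ≢ p
      uv-differs p∈ e with ∈-leafPairs⁻ p∈
      ... | h , z , h-hub , z∈ , refl with ordered-injective e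
      ...   | inj₁ (_ , v≡z) = leaf-not-hub z∈ (inj₂ (sym v≡z))
      ...   | inj₂ (u≡z , _) = leaf-not-hub z∈ (inj₁ (sym u≡z))

    otherPairs : List (Fin n × Fin n)
    otherPairs = filter (¬? ∘ Touches?) edgePairs

    others : List (Permutation′ n)
    others = map tr otherPairs

    pairs-split : edgePairs ↭ hubPairs ++ otherPairs
    pairs-split = ∼bag⇒↭ (unique∧set⇒bag edgePairs-unique
      (++⁺ hubPairs-unique (filter⁺ (¬? ∘ Touches?) edgePairs-unique) disjoint) (mk⇔ split join))
      where
      ∈-otherPairs⁻ : ∀ {p} → p ∈ otherPairs → p ∈ edgePairs × ¬ Touches p
      ∈-otherPairs⁻ = ∈-filter⁻ (¬? ∘ Touches?) {xs = edgePairs}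
      disjoint : Disjoint hubPairs otherPairs
      disjoint (p∈hub , p∈other) = proj₂ (∈-otherPairs⁻ p∈other) (proj₂ (∈-hubPairs⁻ p∈hub))
      split : ∀ {p} → p ∈ edgePairs → p ∈ hubPairs ++ otherPairs
      split {p} p∈ with Touches? p
      ... | yes touches = ∈-++⁺ˡ (∈-hubPairs⁺ p∈ touches)
      ... | no avoids = ∈-++⁺ʳ hubPairs (∈-filter⁺ (¬? ∘ Touches?) p∈ avoids)
      join : ∀ {p} → p ∈ hubPairs ++ otherPairs → p ∈ edgePairs
      join p∈ with ∈-++⁻ hubPairs p∈
      ... | inj₁ p∈hub = proj₁ (∈-hubPairs⁻ p∈hub)
      ... | inj₂ p∈other = proj₁ (∈-otherPairs⁻ p∈other)

    decomposition : edgeTranspositions G ↭ others ++ Edges leaves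
    decomposition = begin
      edgeTranspositions G              ≡⟨ edgePairs-tr ⟩
      map tr edgePairs                  ↭⟨ map⁺ tr pairs-split ⟩
      map tr (hubPairs ++ otherPairs)   ≡⟨ map-++ tr hubPairs otherPairs ⟩
      map tr hubPairs ++ others         ≡⟨ cong (_++ others) hubPairs-tr ⟩
      Edges leaves ++ others            ↭⟨ ++-comm (Edges leaves) others ⟩
      others ++ Edges leaves            ∎
      where open PermutationReasoning

    edges-transpositions : All IsTransposition (edgeTranspositions G)
    edges-transpositions = subst (All IsTransposition) (sym edgePairs-tr) (All.map⁺ (All.tabulate edgePair-transposition))

    others-transpositions : All IsTransposition others
    others-transpositions = All.map⁺ (All.tabulate (edgePair-transposition ∘ proj₁ ∘ ∈-filter⁻ (¬? ∘ Touches?) {xs = edgePairs}))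

open import Defs using (SimpleGraph; Connected; Central; PermCompleteGraph; edgeTranspositions)
open Sign using (parity; parity-+)
open Arrangements using (Covers; Covers-resp-↭; Covers-++; PermComplete-by-parity)
open DoubleStars using (module DoubleStar)
open EdgeLists using (module EdgeDecomposition)
open import Data.Nat using (ℕ; _+_)
open import Data.Bool using (true; _xor_)
open import Data.Fin using (Fin)
open import Data.List using (length)
open import Data.List.Properties using (length-++)
open import Data.List.Relation.Binary.Permutation.Propositional using (↭-sym)
open import Data.List.Relation.Binary.Permutation.Propositional.Properties using (↭-length)
open import Data.Product using (Σ; _×_; _,_)
open import Relation.Binary.PropositionalEquality

-- The edges of G are transpositions, and they cover the sign class of their
-- number: the double star covers the odd class, the other edges in front of
-- it shift that class by their number.
corollary2p12 : (n : ℕ) (G : SimpleGraph n) → Connected G →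
    (Σ (Fin n) λ x → Σ (Fin n) λ y → (x ≢ y) × Central G x × Central G y) →
    PermCompleteGraph G
corollary2p12 n G _ (u , v , u≢v , u-central , v-central) =
  PermComplete-by-parity edges-transpositions (subst (Covers (edgeTranspositions G)) (sym parity-of-length) edges-cover)
  where
  open EdgeDecomposition G u v u≢v u-central v-central
  open DoubleStar u v u≢v using (Edges; Edges-cover; Edges-odd)
  edges-cover : Covers (edgeTranspositions G) (parity (length others) xor true)
  edges-cover = Covers-resp-↭ (↭-sym decomposition) (Covers-++ others-transpositions (Edges-cover leaves Span-unique spanning))
  parity-of-length : parity (length (edgeTranspositions G)) ≡ parity (length others) xor true
  parity-of-length = begin
    parity (length (edgeTranspositions G))                    ≡⟨ cong parity (trans (↭-length decomposition) (length-++ others)) ⟩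
    parity (length others + length (Edges leaves))   ≡⟨ parity-+ (length others) _ ⟩
    parity (length others) xor parity (length (Edges leaves)) ≡⟨ cong (parity (length others) xor_) (Edges-odd leaves) ⟩
    parity (length others) xor true                           ∎
    where open ≡-Reasoning
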